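{- Let $D$ be a diagram in $[n]\times[n]$ such that there exist $1\le i_1<i_2\le n$ and $1\le j_1<j_2\le n$ with $(i_1,j_1),(i_1,j_2)\notin D$ and $(i_2,j_1),(i_2,j_2)\in D$. Then the family of polynomials $\big(\det(Y_D^C)\big)_{C\le D}$, indexed by all diagrams $C\le D$, is linearly dependent over $\mathbb{C}$.
   Context: Write $[n]=\{1,\dots,n\}$. A diagram is a subset $D\subseteq[n]\times[n]$; $(i,j)$ is the box in row $i$, column $j$. We identify $D$ with $(D_1,\dots,D_n)$, $i\in D_j$ iff $(i,j)\in D$. For $R=\{r_1<\dots<r_m\}$, $S=\{s_1<\dots<s_m\}\subseteq[n]$, $R\le S$ means $r_k\le s_k$ for all $k$; for diagrams, $C\le D$ means $|C_j|=|D_j|$ and $C_j\le D_j$ for all $j$. $Y$ is the upper-triangular $n\times n$ matrix with entries indeterminates $y_{ij}$ ($i\le j$) and $0$ below the diagonal; $Y^R_S$ is the submatrix of $Y$ with rows indexed by $R$ and columns indexed by $S$; $\det(Y_D^C)=\prod_{j=1}^n\det(Y^{C_j}_{D_j})$. These polynomials span the flagged Weyl module $\mathcal{M}_D$. -}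

module Defs where

open import Data.Bool using (Bool; true; false; if_then_else_)
open import Data.Nat using (ℕ; zero; suc; _≤ᵇ_)
open import Data.Fin using (Fin; toℕ)
import Data.Fin as Fin
open import Data.List using (List; []; _∷_; map; foldr; zip; upTo; allFin; filterᵇ; length)
open import Data.List.Relation.Binary.Pointwise using (Pointwise)
open import Data.List.Relation.Unary.All using (All)
open import Data.List.Relation.Unary.Any using (Any)
open import Data.List.Relation.Unary.AllPairs using (AllPairs)
open import Data.Product using (Σ; Σ-syntax; _×_; _,_; proj₁; proj₂)
open import Data.Rational using (ℚ; 0ℚ; 1ℚ; _+_; _*_; -_)
open import Relation.Binary.PropositionalEquality using (_≡_)
open import Relation.Nullary using (¬_)

-- A diagram D ⊆ [n]×[n], with rows and columns indexed by Fin n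
-- (Fin index k stands for k+1 ∈ [n]).  D i j ≡ true  iff  (i,j) ∈ D.
Diagram : ℕ → Set
Diagram n = Fin n → Fin n → Bool

col : ∀ {n} → Diagram n → Fin n → List (Fin n)
col {n} D j = filterᵇ (λ i → D i j) (allFin n)

_≤ₛ_ : ∀ {n} → List (Fin n) → List (Fin n) → Set
R ≤ₛ S = Pointwise Fin._≤_ R S

_≤D_ : ∀ {n} → Diagram n → Diagram n → Set
C ≤D D = ∀ j → col C j ≤ₛ col D j

_≐_ : ∀ {n} → Diagram n → Diagram n → Set
C ≐ D = ∀ i j → C i j ≡ D i j

-- Determinant of a square matrix given as a list of rows, by Laplace
-- expansion along the first row (fuel = number of rows).
dropAt : {A : Set} → ℕ → List A → List A
dropAt _ [] = []
dropAt zero (x ∷ xs) = xs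
dropAt (suc k) (x ∷ xs) = x ∷ dropAt k xs

sgn : ℕ → ℚ
sgn zero = 1ℚ
sgn (suc k) = - sgn k

sumℚ : List ℚ → ℚ
sumℚ = foldr _+_ 0ℚ

prodℚ : List ℚ → ℚ
prodℚ = foldr _*_ 1ℚ

detN : ℕ → List (List ℚ) → ℚ
detN zero _ = 1ℚ
detN (suc k) [] = 1ℚ
detN (suc k) (row ∷ rows) =
  sumℚ (map (λ p → sgn (proj₁ p) * (proj₂ p * detN k (map (dropAt (proj₁ p)) rows)))
            (zip (upTo (length row)) row))

det : List (List ℚ) → ℚ
det M = detN (length M) M

-- A point of evaluation for the indeterminates: y i j is the value of y_{ij}.
-- Y is upper triangular: entry (r,s) is y_{rs} if r ≤ s and 0 otherwise.
Yentry : ∀ {n} → (Fin n → Fin n → ℚ) → Fin n → Fin n → ℚ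
Yentry y r s = if toℕ r ≤ᵇ toℕ s then y r s else 0ℚ

subY : ∀ {n} → (Fin n → Fin n → ℚ) → List (Fin n) → List (Fin n) → List (List ℚ)
subY y R S = map (λ r → map (λ s → Yentry y r s) S) R

detYD : ∀ {n} → (Fin n → Fin n → ℚ) → Diagram n → Diagram n → ℚ
detYD {n} y C D = prodℚ (map (λ j → det (subY y (col C j) (col D j))) (allFin n))

-- The family (det(Y^C_D))_{C ≤ D} is linearly dependent: there is a finite
-- list of pairwise distinct indices C ≤ D with coefficients, not all zero,
-- whose linear combination is the zero polynomial (checked as the zero
-- function on all rational points, which is equivalent since ℚ is infinite).
LinDepFamily : ∀ {n} → Diagram n → Set
LinDepFamily {n} D =
  Σ[ terms ∈ List (Diagram n × ℚ) ]
      All (λ t → proj₁ t ≤D D) terms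
    × AllPairs (λ s t → ¬ (proj₁ s ≐ proj₁ t)) terms
    × Any (λ t → ¬ (proj₂ t ≡ 0ℚ)) terms
    × (∀ (y : Fin n → Fin n → ℚ) →
         sumℚ (map (λ t → proj₂ t * detYD y (proj₁ t) D) terms) ≡ 0ℚ)

HasPattern : ∀ {n} → Diagram n → Set
HasPattern {n} D =
  Σ[ i₁ ∈ Fin n ] Σ[ i₂ ∈ Fin n ] Σ[ j₁ ∈ Fin n ] Σ[ j₂ ∈ Fin n ]
    (i₁ Fin.< i₂) × (j₁ Fin.< j₂)
    × (D i₁ j₁ ≡ false) × (D i₁ j₂ ≡ false)
    × (D i₂ j₁ ≡ true) × (D i₂ j₂ ≡ true)

{-# OPTIONS --safe #-}
-- Write D₁, D₂ for the columns j₁, j₂ of D. Moving i₁ and i₂ towards each other, we may assume that every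
-- row strictly between them lies in exactly one of D₁, D₂. Consider the square matrix with columns
-- D₁ ⊔ D₂ having, for each row x of the window [i₁, i₂], the row x of Y on both blocks and, for each row x
-- outside the window and each of D₁, D₂ containing x, the row x of Y on that block and only its entry in
-- column i₂ on the other block; the normalisation makes it square. Its two columns labelled i₂ agree, so
-- its determinant vanishes. Laplace expansion along the two blocks writes it as Σ ± det Y^R_{D₁} det Y^S_{D₂}
-- over the splits (R, S) of its rows. A split sending an outside row x to the wrong block contributes 0
-- (a zero row if x > i₂, too few rows for the columns c < i₁ if x < i₁), and so does a split with R ≰ D₁
-- or S ≰ D₂, as Y is upper triangular. The remaining splits give pairwise distinct diagrams C ≤ D
-- that differ from D in columns j₁ and j₂ only, and the one sending the window rows of D₁ to the left
-- block has coefficient ±1. Multiplying by the minors of the other columns of D gives a nontrivial relation.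
module Submission where

open import Data.Bool using (Bool; true; false; if_then_else_; not; _∧_; _xor_)
import Data.Bool.Properties as Boolₚ
open import Data.Empty using (⊥-elim)
open import Data.Fin as Fin using (Fin; toℕ)
import Data.Fin.Properties as Finₚ
open import Data.List
  using (List; []; _∷_; map; length; _++_; zip; upTo; applyUpTo; allFin; filterᵇ; filter; concatMap; [_])
open import Data.List.Properties
  using (length-map; length-++; map-∘; map-cong; map-cong-local; map-++; ++-assoc; ∷-injective; ∷-injectiveʳ; map-tabulate)
open import Data.List.Membership.Propositional using (_∈_)
import Data.List.Membership.Propositional.Properties as Memₚ
open import Data.List.Relation.Binary.Pointwise using (Pointwise; []; _∷_)
import Data.List.Relation.Binary.Pointwise.Properties as Pointwiseₚ
open import Data.List.Relation.Unary.All as All using (All; []; _∷_)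
import Data.List.Relation.Unary.All.Properties as Allₚ
open import Data.List.Relation.Unary.AllPairs as AllPairs using (AllPairs; []; _∷_)
import Data.List.Relation.Unary.AllPairs.Properties as AllPairsₚ
open import Data.List.Relation.Unary.Any as Any using (Any; here; there)
import Data.List.Relation.Unary.Any.Properties as Anyₚ
open import Data.Nat as ℕ using (ℕ; zero; suc; z≤n; s≤s)
import Data.Nat.Properties as ℕₚ
open import Algebra.Properties.CommutativeSemigroup ℕₚ.+-commutativeSemigroup using (interchange; x∙yz≈y∙xz)
open import Data.Product using (Σ; Σ-syntax; _×_; _,_; proj₁; proj₂)
open import Data.Rational using (ℚ; 0ℚ; 1ℚ; _+_; _*_; -_; ½)
import Data.Rational.Properties as ℚₚ
open import Data.Rational.Solver using (module +-*-Solver)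
open import Data.Sum using (_⊎_; inj₁; inj₂)
open import Function using (_∘_; id)
open import Function.Bundles using (module Equivalence)
open import Relation.Binary using (tri<; tri≈; tri>)
open import Relation.Binary.PropositionalEquality hiding ([_])
open import Relation.Nullary using (¬_; Dec; yes; no; does)
open import Relation.Nullary.Decidable using (T?; _×-dec_; dec-true; dec-false)
open import Relation.Unary using (Decidable)

open import Defs

open +-*-Solver using (solve; _:=_; _:+_; _:*_; :-_; con)

private
  variable
    A B E X : Set

x≡-x⇒x≡0 : ∀ (x : ℚ) → x ≡ - x → x ≡ 0ℚ
x≡-x⇒x≡0 x x≡-x = begin
  x              ≡⟨ solve 1 (λ x → x := con ½ :* (x :+ x)) refl x ⟩
  ½ * (x + x)    ≡⟨ cong (λ z → ½ * (x + z)) x≡-x ⟩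
  ½ * (x + - x)  ≡⟨ solve 1 (λ x → con ½ :* (x :+ :- x) := con 0ℚ) refl x ⟩
  0ℚ             ∎
  where open ≡-Reasoning

sumℚ-++ : ∀ xs ys → sumℚ (xs ++ ys) ≡ sumℚ xs + sumℚ ys
sumℚ-++ []       ys = sym (ℚₚ.+-identityˡ (sumℚ ys))
sumℚ-++ (x ∷ xs) ys = trans (cong (x +_) (sumℚ-++ xs ys)) (sym (ℚₚ.+-assoc x (sumℚ xs) (sumℚ ys)))

sumℚ-*ˡ : ∀ c (f : A → ℚ) xs → sumℚ (map (λ s → c * f s) xs) ≡ c * sumℚ (map f xs)
sumℚ-*ˡ c f []       = sym (ℚₚ.*-zeroʳ c)
sumℚ-*ˡ c f (x ∷ xs) = trans (cong (c * f x +_) (sumℚ-*ˡ c f xs))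
                             (sym (ℚₚ.*-distribˡ-+ c (f x) (sumℚ (map f xs))))

sumℚ-filter : ∀ {P : A → Set} (P? : Decidable P) (f : A → ℚ) xs → All (λ x → ¬ P x → f x ≡ 0ℚ) xs →
  sumℚ (map f (filter P? xs)) ≡ sumℚ (map f xs)
sumℚ-filter P? f []       []                = refl
sumℚ-filter P? f (x ∷ xs) (dropped≡0 ∷ rest) with P? x
... | yes _  = cong (f x +_) (sumℚ-filter P? f xs rest)
... | no ¬Px = trans (sumℚ-filter P? f xs rest)
                     (trans (sym (ℚₚ.+-identityˡ _)) (cong (_+ sumℚ (map f xs)) (sym (dropped≡0 ¬Px))))

AllPairs-restrict : ∀ {P : A → Set} {R R′ : A → A → Set} {xs} → All P xs → AllPairs R xs →
  (∀ {x y} → P x → P y → R x y → R′ x y) → AllPairs R′ xs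
AllPairs-restrict []         []         f = []
AllPairs-restrict (px ∷ pxs) (rx ∷ rxs) f = All.zipWith (λ (py , r) → f px py r) (pxs , rx) ∷ AllPairs-restrict pxs rxs f

σ*[a*b]≡0 : ∀ σ {a b} → a ≡ 0ℚ ⊎ b ≡ 0ℚ → σ * (a * b) ≡ 0ℚ
σ*[a*b]≡0 σ {b = b} (inj₁ refl) = trans (cong (σ *_) (ℚₚ.*-zeroˡ b)) (ℚₚ.*-zeroʳ σ)
σ*[a*b]≡0 σ {a = a} (inj₂ refl) = trans (cong (σ *_) (ℚₚ.*-zeroʳ a)) (ℚₚ.*-zeroʳ σ)

∧-true⁻¹ : ∀ {a b} → a ∧ b ≡ true → a ≡ true × b ≡ true
∧-true⁻¹ {true} {true} _ = refl , refl

dec-true⁻¹ : ∀ {P : Set} (p? : Dec P) → does p? ≡ true → P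
dec-true⁻¹ (yes p) _ = p

dec-false⁻¹ : ∀ {P : Set} (p? : Dec P) → does p? ≡ false → ¬ P
dec-false⁻¹ (no ¬p) _ = ¬p

countᵇ : (A → Bool) → List A → ℕ
countᵇ p []       = 0
countᵇ p (x ∷ xs) = if p x then suc (countᵇ p xs) else countᵇ p xs

countᵇ-++ : ∀ (p : A → Bool) xs ys → countᵇ p (xs ++ ys) ≡ countᵇ p xs ℕ.+ countᵇ p ys
countᵇ-++ p []       ys = refl
countᵇ-++ p (x ∷ xs) ys with p x
... | true  = cong suc (countᵇ-++ p xs ys)
... | false = countᵇ-++ p xs ys

countᵇ-cong : ∀ {p q : A → Bool} xs → All (λ x → p x ≡ q x) xs → countᵇ p xs ≡ countᵇ q xs
countᵇ-cong {q = q} []       []         = refl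
countᵇ-cong {q = q} (x ∷ xs) (px≡qx ∷ eqs) rewrite px≡qx =
  cong (λ m → if q x then suc m else m) (countᵇ-cong xs eqs)

countᵇ-true : ∀ (xs : List A) → countᵇ (λ _ → true) xs ≡ length xs
countᵇ-true []       = refl
countᵇ-true (x ∷ xs) = cong suc (countᵇ-true xs)

countᵇ-none : ∀ (p : A → Bool) xs → All (λ x → p x ≡ false) xs → countᵇ p xs ≡ 0
countᵇ-none p []       []         = refl
countᵇ-none p (x ∷ xs) (px ∷ pxs) rewrite px = countᵇ-none p xs pxs

countᵇ-∈ : ∀ (p : A → Bool) {x} xs → x ∈ xs → p x ≡ true → 1 ℕ.≤ countᵇ p xs
countᵇ-∈ p (x ∷ xs) (here refl) px rewrite px = s≤s z≤n
countᵇ-∈ p (y ∷ xs) (there x∈xs) px with p y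
... | true  = s≤s z≤n
... | false = countᵇ-∈ p xs x∈xs px

countᵇ-∷-≤ : ∀ (p : A → Bool) x xs → countᵇ p (x ∷ xs) ℕ.≤ suc (countᵇ p xs)
countᵇ-∷-≤ p x xs with p x
... | true  = ℕₚ.≤-refl
... | false = ℕₚ.n≤1+n _

countᵇ-map : ∀ (p : B → Bool) (f : A → B) xs → countᵇ p (map f xs) ≡ countᵇ (p ∘ f) xs
countᵇ-map p f []       = refl
countᵇ-map p f (x ∷ xs) with p (f x)
... | true  = cong suc (countᵇ-map p f xs)
... | false = countᵇ-map p f xs

length-filterᵇ : ∀ (p : A → Bool) xs → length (filterᵇ p xs) ≡ countᵇ p xs
length-filterᵇ p []       = refl
length-filterᵇ p (x ∷ xs) with p x
... | true  = cong suc (length-filterᵇ p xs)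
... | false = length-filterᵇ p xs

countᵇ-filterᵇ : ∀ (p q : A → Bool) xs → countᵇ q (filterᵇ p xs) ≡ countᵇ (λ x → p x ∧ q x) xs
countᵇ-filterᵇ p q []       = refl
countᵇ-filterᵇ p q (x ∷ xs) with p x
... | false = countᵇ-filterᵇ p q xs
... | true with q x
...   | true  = cong suc (countᵇ-filterᵇ p q xs)
...   | false = countᵇ-filterᵇ p q xs

filterᵇ-cong : ∀ {p q : A → Bool} xs → All (λ x → p x ≡ q x) xs → filterᵇ p xs ≡ filterᵇ q xs
filterᵇ-cong {q = q} []       []             = refl
filterᵇ-cong {q = q} (x ∷ xs) (px≡qx ∷ eqs) with q x
... | true  rewrite px≡qx = cong (x ∷_) (filterᵇ-cong xs eqs)
... | false rewrite px≡qx = filterᵇ-cong xs eqs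

indicator : Bool → ℕ
indicator true  = 1
indicator false = 0

countᵇ-∷ : ∀ (p : A → Bool) x xs → countᵇ p (x ∷ xs) ≡ indicator (p x) ℕ.+ countᵇ p xs
countᵇ-∷ p x xs with p x
... | true  = refl
... | false = refl

countᵇ-+-cong : ∀ (p q p′ q′ : A → Bool) xs →
  (∀ x → indicator (p x) ℕ.+ indicator (q x) ≡ indicator (p′ x) ℕ.+ indicator (q′ x)) →
  countᵇ p xs ℕ.+ countᵇ q xs ≡ countᵇ p′ xs ℕ.+ countᵇ q′ xs
countᵇ-+-cong p q p′ q′ []       pointwise = refl
countᵇ-+-cong p q p′ q′ (x ∷ xs) pointwise = begin
  countᵇ p (x ∷ xs) ℕ.+ countᵇ q (x ∷ xs)
    ≡⟨ cong₂ ℕ._+_ (countᵇ-∷ p x xs) (countᵇ-∷ q x xs) ⟩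
  (indicator (p x) ℕ.+ countᵇ p xs) ℕ.+ (indicator (q x) ℕ.+ countᵇ q xs)
    ≡⟨ interchange (indicator (p x)) (countᵇ p xs) (indicator (q x)) (countᵇ q xs) ⟩
  (indicator (p x) ℕ.+ indicator (q x)) ℕ.+ (countᵇ p xs ℕ.+ countᵇ q xs)
    ≡⟨ cong₂ ℕ._+_ (pointwise x) (countᵇ-+-cong p q p′ q′ xs pointwise) ⟩
  (indicator (p′ x) ℕ.+ indicator (q′ x)) ℕ.+ (countᵇ p′ xs ℕ.+ countᵇ q′ xs)
    ≡⟨ interchange (indicator (p′ x)) (indicator (q′ x)) (countᵇ p′ xs) (countᵇ q′ xs) ⟩
  (indicator (p′ x) ℕ.+ countᵇ p′ xs) ℕ.+ (indicator (q′ x) ℕ.+ countᵇ q′ xs)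
    ≡⟨ sym (cong₂ ℕ._+_ (countᵇ-∷ p′ x xs) (countᵇ-∷ q′ x xs)) ⟩
  countᵇ p′ (x ∷ xs) ℕ.+ countᵇ q′ (x ∷ xs) ∎
  where open ≡-Reasoning

countᵇ-concatMap : ∀ (p : B → Bool) (f : A → List B) (q : A → Bool) xs →
  (∀ x → countᵇ p (f x) ≡ indicator (q x)) → countᵇ p (concatMap f xs) ≡ countᵇ q xs
countᵇ-concatMap p f q []       per-x = refl
countᵇ-concatMap p f q (x ∷ xs) per-x =
  trans (countᵇ-++ p (f x) (concatMap f xs))
        (trans (cong₂ ℕ._+_ (per-x x) (countᵇ-concatMap p f q xs per-x)) (sym (countᵇ-∷ q x xs)))

allFin-suc : ∀ n → allFin (suc n) ≡ Fin.zero ∷ map Fin.suc (allFin n)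
allFin-suc n = cong (Fin.zero ∷_) (sym (map-tabulate id Fin.suc))

countᵇ-allFin-≟ : ∀ {n} (c : Fin n) (r : Fin n → Bool) →
  countᵇ (λ x → does (x Finₚ.≟ c) ∧ r x) (allFin n) ≡ indicator (r c)
countᵇ-allFin-≟ {suc n} Fin.zero r =
  trans (cong (countᵇ p) (allFin-suc n))
        (trans (countᵇ-∷ p Fin.zero (map Fin.suc (allFin n)))
               (trans (cong (indicator (r Fin.zero) ℕ.+_)
                            (trans (countᵇ-map p Fin.suc (allFin n))
                                   (countᵇ-none _ (allFin n) (All.tabulate (λ _ → refl)))))
                      (ℕₚ.+-identityʳ _)))
  where
  p : Fin (suc n) → Bool
  p x = does (x Finₚ.≟ Fin.zero) ∧ r x
countᵇ-allFin-≟ {suc n} (Fin.suc c) r =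
  trans (cong (countᵇ p) (allFin-suc n))
        (trans (countᵇ-map p Fin.suc (allFin n)) (countᵇ-allFin-≟ c (r ∘ Fin.suc)))
  where
  p : Fin (suc n) → Bool
  p x = does (x Finₚ.≟ Fin.suc c) ∧ r x

prodℚ-allFin-suc : ∀ {n} (f : Fin (suc n) → ℚ) →
  prodℚ (map f (allFin (suc n))) ≡ f Fin.zero * prodℚ (map (f ∘ Fin.suc) (allFin n))
prodℚ-allFin-suc f =
  cong (λ xs → f Fin.zero * prodℚ xs) (trans (map-tabulate Fin.suc f) (sym (map-tabulate id (f ∘ Fin.suc))))

except : ∀ {n} → Fin n → (Fin n → ℚ) → Fin n → ℚ
except j f i = if does (i Finₚ.≟ j) then 1ℚ else f i

prodℚ-allFin-except : ∀ {n} (f : Fin n → ℚ) j → prodℚ (map f (allFin n)) ≡ f j * prodℚ (map (except j f) (allFin n))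
prodℚ-allFin-except {suc n} f Fin.zero =
  trans (prodℚ-allFin-suc f)
        (cong (f Fin.zero *_) (trans (sym (ℚₚ.*-identityˡ _)) (sym (prodℚ-allFin-suc (except Fin.zero f)))))
prodℚ-allFin-except {suc n} f (Fin.suc j) =
  trans (prodℚ-allFin-suc f)
    (trans (cong (f Fin.zero *_) (prodℚ-allFin-except (f ∘ Fin.suc) j))
      (trans (solve 3 (λ a b p → a :* (b :* p) := b :* (a :* p)) refl (f Fin.zero) (f (Fin.suc j)) _)
             (cong (f (Fin.suc j) *_) (sym (prodℚ-allFin-suc (except (Fin.suc j) f))))))

except-cong : ∀ {n} (f g : Fin n → ℚ) i j → (∀ k → k ≢ i → k ≢ j → f k ≡ g k) →
  ∀ k → except j (except i f) k ≡ except j (except i g) k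
except-cong f g i j f≗g k with k Finₚ.≟ j | k Finₚ.≟ i
... | yes _   | _       = refl
... | no _    | yes _   = refl
... | no k≢j  | no k≢i  = f≗g k k≢i k≢j

-- Determinants of matrices given by rows

matrix : List (X → ℚ) → List X → List (List ℚ)
matrix G C = map (λ g → map g C) G

detRows : List (X → ℚ) → List X → ℚ
detRows G C = detN (length G) (matrix G C)

-- Expansion along a row g: column c in position p of L contributes sgn (k + p) · g c · φ (L without c).
cofactorSum : List X → (X → ℚ) → (List X → ℚ) → ℕ → ℚ
cofactorSum []      g φ k = 0ℚ
cofactorSum (c ∷ L) g φ k = sgn k * (g c * φ L) + cofactorSum L g (λ W → φ (c ∷ W)) (suc k)

module _ (g : X → ℚ) where

  cofactorSum-cong : ∀ L φ ψ k → (∀ W → suc (length W) ≡ length L → φ W ≡ ψ W) →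
                     cofactorSum L g φ k ≡ cofactorSum L g ψ k
  cofactorSum-cong []      φ ψ k eq = refl
  cofactorSum-cong (c ∷ L) φ ψ k eq =
    cong₂ _+_ (cong (λ z → sgn k * (g c * z)) (eq L refl))
              (cofactorSum-cong L _ _ (suc k) (λ W e → eq (c ∷ W) (cong suc e)))

  cofactorSum-++ : ∀ L₁ L₂ φ k → cofactorSum (L₁ ++ L₂) g φ k ≡
                   cofactorSum L₁ g (λ W → φ (W ++ L₂)) k + cofactorSum L₂ g (λ W → φ (L₁ ++ W)) (length L₁ ℕ.+ k)
  cofactorSum-++ []       L₂ φ k = sym (ℚₚ.+-identityˡ _)
  cofactorSum-++ (c ∷ L₁) L₂ φ k = begin
    t + cofactorSum (L₁ ++ L₂) g (λ W → φ (c ∷ W)) (suc k)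
      ≡⟨ cong (t +_) (cofactorSum-++ L₁ L₂ (λ W → φ (c ∷ W)) (suc k)) ⟩
    t + (s₁ + cofactorSum L₂ g (λ W → φ (c ∷ L₁ ++ W)) (length L₁ ℕ.+ suc k))
      ≡⟨ cong (λ i → t + (s₁ + cofactorSum L₂ g (λ W → φ (c ∷ L₁ ++ W)) i)) (ℕₚ.+-suc (length L₁) k) ⟩
    t + (s₁ + cofactorSum L₂ g (λ W → φ (c ∷ L₁ ++ W)) (suc (length L₁ ℕ.+ k)))
      ≡⟨ sym (ℚₚ.+-assoc t s₁ _) ⟩
    (t + s₁) + cofactorSum L₂ g (λ W → φ (c ∷ L₁ ++ W)) (suc (length L₁ ℕ.+ k)) ∎
    where
    open ≡-Reasoning
    t s₁ : ℚ
    t  = sgn k * (g c * φ (L₁ ++ L₂))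
    s₁ = cofactorSum L₁ g (λ W → φ (c ∷ W ++ L₂)) (suc k)

  cofactorSum-sgn-suc : ∀ L φ k → cofactorSum L g φ (suc k) ≡ - cofactorSum L g φ k
  cofactorSum-sgn-suc []      φ k = refl
  cofactorSum-sgn-suc (c ∷ L) φ k =
    trans (cong (- sgn k * (g c * φ L) +_) (cofactorSum-sgn-suc L _ (suc k)))
          (solve 3 (λ s x e → (:- s) :* x :+ :- e := :- (s :* x :+ e)) refl (sgn k) (g c * φ L) _)

  cofactorSum-sgn-+ : ∀ L φ a k → cofactorSum L g φ (a ℕ.+ k) ≡ sgn a * cofactorSum L g φ k
  cofactorSum-sgn-+ L φ zero    k = sym (ℚₚ.*-identityˡ _)
  cofactorSum-sgn-+ L φ (suc a) k =
    trans (cofactorSum-sgn-suc L φ (a ℕ.+ k))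
          (trans (cong -_ (cofactorSum-sgn-+ L φ a k)) (ℚₚ.neg-distribˡ-* (sgn a) _))

  cofactorSum-zero : ∀ L k → cofactorSum L g (λ _ → 0ℚ) k ≡ 0ℚ
  cofactorSum-zero []      k = refl
  cofactorSum-zero (c ∷ L) k =
    trans (cong (sgn k * (g c * 0ℚ) +_) (cofactorSum-zero L (suc k)))
          (solve 2 (λ s x → s :* (x :* con 0ℚ) :+ con 0ℚ := con 0ℚ) refl (sgn k) (g c))

  cofactorSum-+ : ∀ L φ ψ k → cofactorSum L g (λ W → φ W + ψ W) k ≡ cofactorSum L g φ k + cofactorSum L g ψ k
  cofactorSum-+ []      φ ψ k = refl
  cofactorSum-+ (c ∷ L) φ ψ k =
    trans (cong (sgn k * (g c * (φ L + ψ L)) +_) (cofactorSum-+ L _ _ (suc k)))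
          (solve 6 (λ s x a b e f → s :* (x :* (a :+ b)) :+ (e :+ f) := (s :* (x :* a) :+ e) :+ (s :* (x :* b) :+ f))
                 refl (sgn k) (g c) (φ L) (ψ L) _ _)

  cofactorSum-*ˡ : ∀ L φ a k → cofactorSum L g (λ W → a * φ W) k ≡ a * cofactorSum L g φ k
  cofactorSum-*ˡ []      φ a k = sym (ℚₚ.*-zeroʳ a)
  cofactorSum-*ˡ (c ∷ L) φ a k =
    trans (cong (sgn k * (g c * (a * φ L)) +_) (cofactorSum-*ˡ L _ a (suc k)))
          (solve 5 (λ s x p a e → s :* (x :* (a :* p)) :+ a :* e := a :* (s :* (x :* p) :+ e)) refl (sgn k) (g c) (φ L) a _)

  cofactorSum-*ʳ : ∀ L φ a k → cofactorSum L g (λ W → φ W * a) k ≡ cofactorSum L g φ k * a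
  cofactorSum-*ʳ L φ a k =
    trans (cofactorSum-cong L _ _ k (λ W _ → ℚₚ.*-comm (φ W) a))
          (trans (cofactorSum-*ˡ L φ a k) (ℚₚ.*-comm a _))

  cofactorSum-neg : ∀ L φ k → cofactorSum L g (λ W → - φ W) k ≡ - cofactorSum L g φ k
  cofactorSum-neg L φ k =
    trans (cofactorSum-cong L _ _ k (λ W _ → solve 1 (λ x → :- x := :- con 1ℚ :* x) refl (φ W)))
          (trans (cofactorSum-*ˡ L φ (- 1ℚ) k) (solve 1 (λ x → :- con 1ℚ :* x := :- x) refl _))

  cofactorSum-sumℚ : ∀ L (F : A → List X → ℚ) ss k →
    sumℚ (map (λ s → cofactorSum L g (F s) k) ss) ≡ cofactorSum L g (λ W → sumℚ (map (λ s → F s W) ss)) k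
  cofactorSum-sumℚ L F []       k = sym (cofactorSum-zero L k)
  cofactorSum-sumℚ L F (s ∷ ss) k =
    trans (cong (cofactorSum L g (F s) k +_) (cofactorSum-sumℚ L F ss k))
          (sym (cofactorSum-+ L (F s) _ k))

  cofactorSum-vanishing : ∀ L φ k → (∀ U c V → L ≡ U ++ c ∷ V → g c * φ (U ++ V) ≡ 0ℚ) → cofactorSum L g φ k ≡ 0ℚ
  cofactorSum-vanishing []      φ k h = refl
  cofactorSum-vanishing (c ∷ L) φ k h =
    trans (cong₂ (λ a b → sgn k * a + b) (h [] c L refl)
                 (cofactorSum-vanishing L _ (suc k) (λ U c′ V e → h (c ∷ U) c′ V (cong (c ∷_) e))))
          (solve 1 (λ s → s :* con 0ℚ :+ con 0ℚ := con 0ℚ) refl (sgn k))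

cofactorSum-map : ∀ (f : A → X) L g φ k → cofactorSum (map f L) g φ k ≡ cofactorSum L (g ∘ f) (φ ∘ map f) k
cofactorSum-map f []      g φ k = refl
cofactorSum-map f (c ∷ L) g φ k =
  cong (sgn k * (g (f c) * φ (map f L)) +_) (cofactorSum-map f L g (λ W → φ (f c ∷ W)) (suc k))

dropAt-map : ∀ p (f : A → B) xs → dropAt p (map f xs) ≡ map f (dropAt p xs)
dropAt-map p       f []       = refl
dropAt-map zero    f (x ∷ xs) = refl
dropAt-map (suc p) f (x ∷ xs) = cong (f x ∷_) (dropAt-map p f xs)

dropAt-++ : ∀ (pre : List A) c C → dropAt (length pre) (pre ++ c ∷ C) ≡ pre ++ C
dropAt-++ []        c C = refl
dropAt-++ (x ∷ pre) c C = cong (x ∷_) (dropAt-++ pre c C)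

firstRowTerm : (List X → ℚ) → List X → ℕ × ℚ → ℚ
firstRowTerm φ F pv = sgn (proj₁ pv) * (proj₂ pv * φ (dropAt (proj₁ pv) F))

firstRowSum : ∀ (g : X → ℚ) φ F pre C k (f : ℕ → ℕ) → F ≡ pre ++ C → length pre ≡ k → (∀ i → f i ≡ k ℕ.+ i) →
  sumℚ (map (firstRowTerm φ F) (zip (applyUpTo f (length C)) (map g C))) ≡ cofactorSum C g (λ W → φ (pre ++ W)) k
firstRowSum g φ F pre []      k f _    _    _  = refl
firstRowSum g φ F pre (c ∷ C) k f refl refl hf = cong₂ _+_ leading rest
  where
  leading : firstRowTerm φ (pre ++ c ∷ C) (f 0 , g c) ≡ sgn (length pre) * (g c * φ (pre ++ C))
  leading rewrite hf 0 | ℕₚ.+-identityʳ (length pre) | dropAt-++ pre c C = refl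
  rest : sumℚ (map (firstRowTerm φ (pre ++ c ∷ C)) (zip (applyUpTo (f ∘ suc) (length C)) (map g C)))
         ≡ cofactorSum C g (λ W → φ (pre ++ c ∷ W)) (suc (length pre))
  rest = trans (firstRowSum g φ _ (pre ++ [ c ]) C (suc (length pre)) (f ∘ suc)
                  (sym (++-assoc pre [ c ] C)) (trans (length-++ pre) (ℕₚ.+-comm (length pre) 1))
                  (λ i → trans (hf (suc i)) (ℕₚ.+-suc (length pre) i)))
               (cofactorSum-cong g C _ _ _ (λ W _ → cong φ (++-assoc pre [ c ] W)))

detRows-∷ : ∀ (g : X → ℚ) G C → detRows (g ∷ G) C ≡ cofactorSum C g (detRows G) 0
detRows-∷ g G C = begin
  detRows (g ∷ G) C
    ≡⟨ cong (λ m → sumℚ (map (λ p → sgn (proj₁ p) * (proj₂ p * detN (length G) (map (dropAt (proj₁ p)) (matrix G C))))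
                             (zip (upTo m) (map g C))))
            (length-map g C) ⟩
  sumℚ (map (λ p → sgn (proj₁ p) * (proj₂ p * detN (length G) (map (dropAt (proj₁ p)) (matrix G C))))
            (zip (upTo (length C)) (map g C)))
    ≡⟨ cong sumℚ (map-cong (λ p → cong (λ m → sgn (proj₁ p) * (proj₂ p * detN (length G) m))
                                        (dropAt-matrix (proj₁ p))) (zip (upTo (length C)) (map g C))) ⟩
  sumℚ (map (firstRowTerm (detRows G) C) (zip (upTo (length C)) (map g C)))
    ≡⟨ firstRowSum g (detRows G) C [] C 0 id refl refl (λ _ → refl) ⟩
  cofactorSum C g (detRows G) 0 ∎
  where
  open ≡-Reasoning
  dropAt-matrix : ∀ p → map (dropAt p) (matrix G C) ≡ matrix G (dropAt p C)
  dropAt-matrix p = trans (sym (map-∘ G)) (map-cong (λ g′ → dropAt-map p g′ C) G)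

detRows-swap : ∀ (G : List (X → ℚ)) P a b Z → length G ≡ length P ℕ.+ suc (suc (length Z)) →
  detRows G (P ++ a ∷ b ∷ Z) ≡ - detRows G (P ++ b ∷ a ∷ Z)
detRows-swap []      P a b Z len = ⊥-elim (ℕₚ.1+n≢0 (trans (sym (ℕₚ.+-suc (length P) (suc (length Z)))) (sym len)))
detRows-swap (g ∷ G) P a b Z len = begin
  detRows (g ∷ G) (P ++ a ∷ b ∷ Z)
    ≡⟨ detRows-∷ g G (P ++ a ∷ b ∷ Z) ⟩
  cofactorSum (P ++ a ∷ b ∷ Z) g minor 0
    ≡⟨ cofactorSum-++ g P (a ∷ b ∷ Z) minor 0 ⟩
  X₁ + (sgn k * (g a * minor (P ++ b ∷ Z)) + (- sgn k * (g b * minor (P ++ a ∷ Z)) + X₄))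
    ≡⟨ cong₂ (λ u v → u + (sgn k * (g a * minor (P ++ b ∷ Z)) + (- sgn k * (g b * minor (P ++ a ∷ Z)) + v))) X₁≡-Y₁ X₄≡-Y₄ ⟩
  - Y₁ + (sgn k * (g a * minor (P ++ b ∷ Z)) + (- sgn k * (g b * minor (P ++ a ∷ Z)) + - Y₄))
    ≡⟨ solve 7 (λ y₁ s ga m₁ gb m₂ y₄ → :- y₁ :+ (s :* (ga :* m₁) :+ ((:- s) :* (gb :* m₂) :+ :- y₄))
                  := :- (y₁ :+ (s :* (gb :* m₂) :+ ((:- s) :* (ga :* m₁) :+ y₄)))) refl
         Y₁ (sgn k) (g a) (minor (P ++ b ∷ Z)) (g b) (minor (P ++ a ∷ Z)) Y₄ ⟩
  - (Y₁ + (sgn k * (g b * minor (P ++ a ∷ Z)) + (- sgn k * (g a * minor (P ++ b ∷ Z)) + Y₄)))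
    ≡⟨ cong -_ (sym (cofactorSum-++ g P (b ∷ a ∷ Z) minor 0)) ⟩
  - cofactorSum (P ++ b ∷ a ∷ Z) g minor 0
    ≡⟨ cong -_ (sym (detRows-∷ g G (P ++ b ∷ a ∷ Z))) ⟩
  - detRows (g ∷ G) (P ++ b ∷ a ∷ Z) ∎
  where
  open ≡-Reasoning
  minor = detRows G
  k : ℕ
  k = length P ℕ.+ 0
  X₁ Y₁ X₄ Y₄ : ℚ
  X₁ = cofactorSum P g (λ W → minor (W ++ a ∷ b ∷ Z)) 0
  Y₁ = cofactorSum P g (λ W → minor (W ++ b ∷ a ∷ Z)) 0
  X₄ = cofactorSum Z g (λ W → minor (P ++ a ∷ b ∷ W)) (suc (suc k))
  Y₄ = cofactorSum Z g (λ W → minor (P ++ b ∷ a ∷ W)) (suc (suc k))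
  X₁≡-Y₁ : X₁ ≡ - Y₁
  X₁≡-Y₁ = trans (cofactorSum-cong g P _ (λ W → - minor (W ++ b ∷ a ∷ Z)) 0
                   (λ W e → detRows-swap G W a b Z
                              (ℕₚ.suc-injective (trans len (cong (ℕ._+ suc (suc (length Z))) (sym e))))))
                 (cofactorSum-neg g P _ 0)
  X₄≡-Y₄ : X₄ ≡ - Y₄
  X₄≡-Y₄ = trans (cofactorSum-cong g Z _ (λ W → - minor (P ++ b ∷ a ∷ W)) (suc (suc k))
                   (λ W e → detRows-swap G P a b W
                              (trans (ℕₚ.suc-injective (trans len (ℕₚ.+-suc (length P) (suc (length Z)))))
                                     (cong (λ z → length P ℕ.+ suc z) (sym e)))))
                 (cofactorSum-neg g Z _ (suc (suc k)))

detRows-equalColumns : ∀ (Q : List X) G P a b Z → length G ≡ length P ℕ.+ suc (length Q ℕ.+ suc (length Z)) →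
  All (λ g → g a ≡ g b) G → detRows G (P ++ a ∷ Q ++ b ∷ Z) ≡ 0ℚ
detRows-equalColumns []      G P a b Z len a≗b =
  x≡-x⇒x≡0 _ (trans (detRows-swap G P a b Z len) (cong (λ m → - detN (length G) m) (sym (swapped G a≗b))))
  where
  swapped : ∀ G → All (λ g → g a ≡ g b) G → matrix G (P ++ a ∷ b ∷ Z) ≡ matrix G (P ++ b ∷ a ∷ Z)
  swapped []      []        = refl
  swapped (g ∷ G) (e ∷ a≗b) =
    cong₂ _∷_ (trans (map-++ g P (a ∷ b ∷ Z))
                     (trans (cong (λ r → map g P ++ r) (cong₂ (λ u v → u ∷ v ∷ map g Z) e (sym e)))
                            (sym (map-++ g P (b ∷ a ∷ Z)))))
              (swapped G a≗b)
detRows-equalColumns (q ∷ Q) G P a b Z len a≗b = begin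
  detRows G (P ++ a ∷ q ∷ Q ++ b ∷ Z)
    ≡⟨ detRows-swap G P a q (Q ++ b ∷ Z) (trans len (cong (λ z → length P ℕ.+ suc (suc z)) (sym (length-++ Q)))) ⟩
  - detRows G (P ++ q ∷ a ∷ Q ++ b ∷ Z)
    ≡⟨ cong (λ W → - detRows G W) (sym (++-assoc P [ q ] (a ∷ Q ++ b ∷ Z))) ⟩
  - detRows G ((P ++ [ q ]) ++ a ∷ Q ++ b ∷ Z)
    ≡⟨ cong -_ (detRows-equalColumns Q G (P ++ [ q ]) a b Z len′ a≗b) ⟩
  - 0ℚ
    ≡⟨⟩
  0ℚ ∎
  where
  open ≡-Reasoning
  len′ : length G ≡ length (P ++ [ q ]) ℕ.+ suc (length Q ℕ.+ suc (length Z))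
  len′ = trans len (trans (sym (ℕₚ.+-assoc (length P) 1 _))
                          (cong (ℕ._+ suc (length Q ℕ.+ suc (length Z))) (sym (length-++ P))))

length-middle : ∀ (U : List A) c V → length (U ++ c ∷ V) ≡ suc (length (U ++ V))
length-middle U c V = trans (length-++ U) (trans (ℕₚ.+-suc (length U) _) (cong suc (sym (length-++ U))))

countᵇ-middle : ∀ (p : A → Bool) U c V → countᵇ p (U ++ c ∷ V) ≡ indicator (p c) ℕ.+ countᵇ p (U ++ V)
countᵇ-middle p []      c V = countᵇ-∷ p c V
countᵇ-middle p (u ∷ U) c V = begin
  countᵇ p (u ∷ U ++ c ∷ V)                                  ≡⟨ countᵇ-∷ p u (U ++ c ∷ V) ⟩
  indicator (p u) ℕ.+ countᵇ p (U ++ c ∷ V)                  ≡⟨ cong (indicator (p u) ℕ.+_) (countᵇ-middle p U c V) ⟩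
  indicator (p u) ℕ.+ (indicator (p c) ℕ.+ countᵇ p (U ++ V)) ≡⟨ x∙yz≈y∙xz (indicator (p u)) (indicator (p c)) _ ⟩
  indicator (p c) ℕ.+ (indicator (p u) ℕ.+ countᵇ p (U ++ V)) ≡⟨ cong (indicator (p c) ℕ.+_) (sym (countᵇ-∷ p u (U ++ V))) ⟩
  indicator (p c) ℕ.+ countᵇ p (u ∷ U ++ V)                  ∎
  where open ≡-Reasoning

-- The columns satisfying P can only be filled by the flagged rows.
detRows-fewSupportingRows : ∀ (row : E → X → ℚ) (flag : E → Bool) (P : X → Bool) G C → length G ≡ length C →
  countᵇ flag G ℕ.< countᵇ P C → All (λ e → flag e ≡ false → ∀ c → P c ≡ true → row e c ≡ 0ℚ) G →
  detRows (map row G) C ≡ 0ℚ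
detRows-fewSupportingRows row flag P []      [] len () vanish
detRows-fewSupportingRows row flag P (e ∷ G) C  len fewer (e-vanish ∷ vanish) =
  trans (detRows-∷ (row e) (map row G) C) (cofactorSum-vanishing (row e) C _ 0 term≡0)
  where
  term≡0 : ∀ U c V → C ≡ U ++ c ∷ V → row e c * detRows (map row G) (U ++ V) ≡ 0ℚ
  term≡0 U c V refl = by-cases (flag e) (P c) refl refl (subst₂ ℕ._<_ (countᵇ-∷ flag e G) (countᵇ-middle P U c V) fewer)
    where
    minor : ℚ
    minor = detRows (map row G) (U ++ V)
    minor≡0 : countᵇ flag G ℕ.< countᵇ P (U ++ V) → row e c * minor ≡ 0ℚ
    minor≡0 fewer′ = trans (cong (row e c *_) (detRows-fewSupportingRows row flag P G (U ++ V)
                                                 (ℕₚ.suc-injective (trans len (length-middle U c V))) fewer′ vanish))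
                           (ℚₚ.*-zeroʳ (row e c))
    by-cases : ∀ f p → flag e ≡ f → P c ≡ p → indicator f ℕ.+ countᵇ flag G ℕ.< indicator p ℕ.+ countᵇ P (U ++ V) →
               row e c * minor ≡ 0ℚ
    by-cases false true  flag-e P-c _      = trans (cong (_* minor) (e-vanish flag-e c P-c)) (ℚₚ.*-zeroˡ minor)
    by-cases false false _      _   fewer′ = minor≡0 fewer′
    by-cases true  true  _      _   fewer′ = minor≡0 (ℕₚ.≤-pred fewer′)
    by-cases true  false _      _   fewer′ = minor≡0 (ℕₚ.<-trans (ℕₚ.n<1+n _) fewer′)

detRows-zeroRow : ∀ (G : List (X → ℚ)) C {g} → g ∈ G → (∀ c → g c ≡ 0ℚ) → length G ≡ length C → detRows G C ≡ 0ℚ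
detRows-zeroRow (g ∷ G) C (here refl) g≡0 len =
  trans (detRows-∷ g G C)
        (cofactorSum-vanishing g C _ 0
          (λ U c V _ → trans (cong (_* detRows G (U ++ V)) (g≡0 c)) (ℚₚ.*-zeroˡ (detRows G (U ++ V)))))
detRows-zeroRow (h ∷ G) C (there g∈G) g≡0 len =
  trans (detRows-∷ h G C) (cofactorSum-vanishing h C _ 0 minor≡0)
  where
  minor≡0 : ∀ U c V → C ≡ U ++ c ∷ V → h c * detRows G (U ++ V) ≡ 0ℚ
  minor≡0 U c V refl =
    trans (cong (h c *_) (detRows-zeroRow G (U ++ V) g∈G g≡0 (ℕₚ.suc-injective (trans len (length-middle U c V)))))
          (ℚₚ.*-zeroʳ (h c))

-- Laplace expansion along two blocks of columns

select : Bool → List E → List Bool → List E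
select v (e ∷ T) (b ∷ bs) = if b xor v then select v T bs else e ∷ select v T bs
select v _       _        = []

toLeft : List Bool × ℚ → List Bool × ℚ
toLeft (bs , σ) = (true ∷ bs , σ)

toRight : ℕ → List Bool × ℚ → List Bool × ℚ
toRight k (bs , σ) = (false ∷ bs , sgn k * σ)

-- Every way of sending k of the rows T to the left block (bit true) and the others to the right
-- block, with the sign of the corresponding term of the Laplace expansion.
splits : List E → ℕ → List (List Bool × ℚ)
splits []      zero    = ([] , 1ℚ) ∷ []
splits []      (suc k) = []
splits (e ∷ T) zero    = map (toRight 0) (splits T 0)
splits (e ∷ T) (suc k) = map toLeft (splits T k) ++ map (toRight (suc k)) (splits T (suc k))

module Laplace (leftRow rightRow : E → X → ℚ) where

  joinRow : E → X ⊎ X → ℚ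
  joinRow e (inj₁ a) = leftRow e a
  joinRow e (inj₂ b) = rightRow e b

  laplaceTerm : List E → List X → List X → List Bool × ℚ → ℚ
  laplaceTerm T A B s =
    proj₂ s * (detRows (map leftRow (select true T (proj₁ s))) A * detRows (map rightRow (select false T (proj₁ s))) B)

  detRows-commonColumn : ∀ T c P Q R S → length T ≡ length (P ++ c ∷ Q) ℕ.+ length (R ++ c ∷ S) →
    All (λ e → leftRow e c ≡ rightRow e c) T → detRows (map joinRow T) (map inj₁ (P ++ c ∷ Q) ++ map inj₂ (R ++ c ∷ S)) ≡ 0ℚ
  detRows-commonColumn T c P Q R S len agree =
    trans (cong (detRows (map joinRow T)) columns)
          (detRows-equalColumns (map inj₁ Q ++ map inj₂ R) (map joinRow T) (map inj₁ P) (inj₁ c) (inj₂ c) (map inj₂ S)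
                                len′ (Allₚ.map⁺ agree))
    where
    open ≡-Reasoning
    columns : map inj₁ (P ++ c ∷ Q) ++ map inj₂ (R ++ c ∷ S)
              ≡ map inj₁ P ++ inj₁ c ∷ (map inj₁ Q ++ map inj₂ R) ++ inj₂ c ∷ map inj₂ S
    columns = trans (cong₂ _++_ (map-++ inj₁ P (c ∷ Q)) (map-++ inj₂ R (c ∷ S)))
      (trans (++-assoc (map inj₁ P) (inj₁ c ∷ map inj₁ Q) (map inj₂ R ++ inj₂ c ∷ map inj₂ S))
             (cong (λ W → map inj₁ P ++ inj₁ c ∷ W) (sym (++-assoc (map inj₁ Q) (map inj₂ R) (inj₂ c ∷ map inj₂ S)))))
    len′ : length (map joinRow T)
           ≡ length (map inj₁ P) ℕ.+ suc (length (map inj₁ Q ++ map inj₂ R) ℕ.+ suc (length (map inj₂ S)))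
    len′ = begin
      length (map joinRow T)
        ≡⟨ trans (length-map joinRow T) len ⟩
      length (P ++ c ∷ Q) ℕ.+ length (R ++ c ∷ S)
        ≡⟨ cong₂ ℕ._+_ (length-++ P) (length-++ R) ⟩
      (length P ℕ.+ suc (length Q)) ℕ.+ (length R ℕ.+ suc (length S))
        ≡⟨ ℕₚ.+-assoc (length P) (suc (length Q)) _ ⟩
      length P ℕ.+ suc (length Q ℕ.+ (length R ℕ.+ suc (length S)))
        ≡⟨ cong (λ m → length P ℕ.+ suc m) (sym (ℕₚ.+-assoc (length Q) (length R) (suc (length S)))) ⟩
      length P ℕ.+ suc ((length Q ℕ.+ length R) ℕ.+ suc (length S))
        ≡⟨ sym (cong₂ (λ p m → p ℕ.+ suc m) (length-map inj₁ P)
                 (cong₂ (λ q s → q ℕ.+ suc s)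
                        (trans (length-++ (map inj₁ Q)) (cong₂ ℕ._+_ (length-map inj₁ Q) (length-map inj₂ R)))
                        (length-map inj₂ S))) ⟩
      length (map inj₁ P) ℕ.+ suc (length (map inj₁ Q ++ map inj₂ R) ℕ.+ suc (length (map inj₂ S))) ∎

  LaplaceExpansion : List E → Set
  LaplaceExpansion T = ∀ A B → length T ≡ length A ℕ.+ length B →
    detRows (map joinRow T) (map inj₁ A ++ map inj₂ B) ≡ sumℚ (map (laplaceTerm T A B) (splits T (length A)))

  module _ (e : E) (T : List E) where

    laplaceTerm-toLeft : ∀ A B s →
      cofactorSum A (leftRow e) (λ W → laplaceTerm T W B s) 0 ≡ laplaceTerm (e ∷ T) A B (toLeft s)
    laplaceTerm-toLeft A B (bs , σ) = begin
      cofactorSum A (leftRow e) (λ W → σ * (detRows L W * r)) 0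
        ≡⟨ cofactorSum-*ˡ (leftRow e) A _ σ 0 ⟩
      σ * cofactorSum A (leftRow e) (λ W → detRows L W * r) 0
        ≡⟨ cong (σ *_) (cofactorSum-*ʳ (leftRow e) A (detRows L) r 0) ⟩
      σ * (cofactorSum A (leftRow e) (detRows L) 0 * r)
        ≡⟨ cong (λ d → σ * (d * r)) (sym (detRows-∷ (leftRow e) L A)) ⟩
      σ * (detRows (leftRow e ∷ L) A * r) ∎
      where
      open ≡-Reasoning
      L : List (X → ℚ)
      L = map leftRow (select true T bs)
      r : ℚ
      r = detRows (map rightRow (select false T bs)) B

    laplaceTerm-toRight : ∀ A B s →
      sgn (length A) * cofactorSum B (rightRow e) (λ W → laplaceTerm T A W s) 0
      ≡ laplaceTerm (e ∷ T) A B (toRight (length A) s)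
    laplaceTerm-toRight A B (bs , σ) = begin
      sgn k * cofactorSum B (rightRow e) (λ W → σ * (l * detRows R W)) 0
        ≡⟨ cong (sgn k *_) (trans (cofactorSum-*ˡ (rightRow e) B _ σ 0)
                                  (cong (σ *_) (cofactorSum-*ˡ (rightRow e) B _ l 0))) ⟩
      sgn k * (σ * (l * cofactorSum B (rightRow e) (detRows R) 0))
        ≡⟨ solve 4 (λ a b c d → a :* (b :* (c :* d)) := (a :* b) :* (c :* d)) refl (sgn k) σ l _ ⟩
      (sgn k * σ) * (l * cofactorSum B (rightRow e) (detRows R) 0)
        ≡⟨ cong (λ d → (sgn k * σ) * (l * d)) (sym (detRows-∷ (rightRow e) R B)) ⟩
      (sgn k * σ) * (l * detRows (rightRow e ∷ R) B) ∎
      where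
      open ≡-Reasoning
      k : ℕ
      k = length A
      l : ℚ
      l = detRows (map leftRow (select true T bs)) A
      R : List (X → ℚ)
      R = map rightRow (select false T bs)

    module _ (expansion : LaplaceExpansion T) where

      expand-leftBlock : ∀ a A B → length T ≡ length A ℕ.+ length B →
        cofactorSum (a ∷ A) (leftRow e) (λ W → detRows (map joinRow T) (map inj₁ W ++ map inj₂ B)) 0
        ≡ sumℚ (map (laplaceTerm (e ∷ T) (a ∷ A) B) (map toLeft (splits T (length A))))
      expand-leftBlock a A B len = begin
        cofactorSum (a ∷ A) (leftRow e) (λ W → detRows (map joinRow T) (map inj₁ W ++ map inj₂ B)) 0
          ≡⟨ cofactorSum-cong (leftRow e) (a ∷ A) _ (λ W → sumℚ (map (laplaceTerm T W B) ss)) 0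
               (λ W eW → trans (expansion W B (trans len (cong (ℕ._+ length B) (sym (ℕₚ.suc-injective eW)))))
                               (cong (λ i → sumℚ (map (laplaceTerm T W B) (splits T i))) (ℕₚ.suc-injective eW))) ⟩
        cofactorSum (a ∷ A) (leftRow e) (λ W → sumℚ (map (laplaceTerm T W B) ss)) 0
          ≡⟨ sym (cofactorSum-sumℚ (leftRow e) (a ∷ A) (λ s W → laplaceTerm T W B s) ss 0) ⟩
        sumℚ (map (λ s → cofactorSum (a ∷ A) (leftRow e) (λ W → laplaceTerm T W B s) 0) ss)
          ≡⟨ cong sumℚ (map-cong (laplaceTerm-toLeft (a ∷ A) B) ss) ⟩
        sumℚ (map (λ s → laplaceTerm (e ∷ T) (a ∷ A) B (toLeft s)) ss)
          ≡⟨ cong sumℚ (map-∘ ss) ⟩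
        sumℚ (map (laplaceTerm (e ∷ T) (a ∷ A) B) (map toLeft ss)) ∎
        where
        open ≡-Reasoning
        ss : List (List Bool × ℚ)
        ss = splits T (length A)

      expand-rightBlock : ∀ A B → suc (length T) ≡ length A ℕ.+ length B →
        cofactorSum B (rightRow e) (λ W → detRows (map joinRow T) (map inj₁ A ++ map inj₂ W)) (length A ℕ.+ 0)
        ≡ sumℚ (map (laplaceTerm (e ∷ T) A B) (map (toRight (length A)) (splits T (length A))))
      expand-rightBlock A B len = begin
        cofactorSum B (rightRow e) (λ W → detRows (map joinRow T) (map inj₁ A ++ map inj₂ W)) (length A ℕ.+ 0)
          ≡⟨ cofactorSum-sgn-+ (rightRow e) B _ (length A) 0 ⟩
        sgn k * cofactorSum B (rightRow e) (λ W → detRows (map joinRow T) (map inj₁ A ++ map inj₂ W)) 0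
          ≡⟨ cong (sgn k *_) (cofactorSum-cong (rightRow e) B _ (λ W → sumℚ (map (laplaceTerm T A W) ss)) 0
               (λ W eW → expansion A W (ℕₚ.suc-injective (trans len (trans (cong (length A ℕ.+_) (sym eW))
                                                                             (ℕₚ.+-suc (length A) (length W))))))) ⟩
        sgn k * cofactorSum B (rightRow e) (λ W → sumℚ (map (laplaceTerm T A W) ss)) 0
          ≡⟨ cong (sgn k *_) (sym (cofactorSum-sumℚ (rightRow e) B (λ s W → laplaceTerm T A W s) ss 0)) ⟩
        sgn k * sumℚ (map (λ s → cofactorSum B (rightRow e) (λ W → laplaceTerm T A W s) 0) ss)
          ≡⟨ sym (sumℚ-*ˡ (sgn k) _ ss) ⟩
        sumℚ (map (λ s → sgn k * cofactorSum B (rightRow e) (λ W → laplaceTerm T A W s) 0) ss)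
          ≡⟨ cong sumℚ (map-cong (laplaceTerm-toRight A B) ss) ⟩
        sumℚ (map (λ s → laplaceTerm (e ∷ T) A B (toRight k s)) ss)
          ≡⟨ cong sumℚ (map-∘ ss) ⟩
        sumℚ (map (laplaceTerm (e ∷ T) A B) (map (toRight k) ss)) ∎
        where
        open ≡-Reasoning
        k : ℕ
        k = length A
        ss : List (List Bool × ℚ)
        ss = splits T k

  detRows-laplace : ∀ T → LaplaceExpansion T
  detRows-laplace []      []      []      len = refl
  detRows-laplace []      []      (b ∷ B) ()
  detRows-laplace []      (a ∷ A) B       ()
  detRows-laplace (e ∷ T) A       B       len = begin
    detRows (map joinRow (e ∷ T)) (map inj₁ A ++ map inj₂ B)
      ≡⟨ detRows-∷ (joinRow e) (map joinRow T) (map inj₁ A ++ map inj₂ B) ⟩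
    cofactorSum (map inj₁ A ++ map inj₂ B) (joinRow e) minor 0
      ≡⟨ cofactorSum-++ (joinRow e) (map inj₁ A) (map inj₂ B) minor 0 ⟩
    cofactorSum (map inj₁ A) (joinRow e) (λ W → minor (W ++ map inj₂ B)) 0
      + cofactorSum (map inj₂ B) (joinRow e) (λ W → minor (map inj₁ A ++ W)) (length (map inj₁ A) ℕ.+ 0)
      ≡⟨ cong₂ _+_ (cofactorSum-map inj₁ A (joinRow e) (λ W → minor (W ++ map inj₂ B)) 0)
                   (trans (cong (λ i → cofactorSum (map inj₂ B) (joinRow e) (λ W → minor (map inj₁ A ++ W)) (i ℕ.+ 0))
                                (length-map inj₁ A))
                          (cofactorSum-map inj₂ B (joinRow e) (λ W → minor (map inj₁ A ++ W)) (length A ℕ.+ 0))) ⟩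
    cofactorSum A (leftRow e) (λ W → minor (map inj₁ W ++ map inj₂ B)) 0
      + cofactorSum B (rightRow e) (λ W → minor (map inj₁ A ++ map inj₂ W)) (length A ℕ.+ 0)
      ≡⟨ cong₂ _+_ (leftBlock A refl) (expand-rightBlock e T (detRows-laplace T) A B len) ⟩
    sumℚ (map (laplaceTerm (e ∷ T) A B) (leftSplits A)) + sumℚ (map (laplaceTerm (e ∷ T) A B) rightSplits)
      ≡⟨ sym (trans (cong sumℚ (map-++ (laplaceTerm (e ∷ T) A B) (leftSplits A) rightSplits))
                    (sumℚ-++ (map (laplaceTerm (e ∷ T) A B) (leftSplits A)) _)) ⟩
    sumℚ (map (laplaceTerm (e ∷ T) A B) (leftSplits A ++ rightSplits))
      ≡⟨ cong (λ ss → sumℚ (map (laplaceTerm (e ∷ T) A B) ss)) (splits-∷ A) ⟩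
    sumℚ (map (laplaceTerm (e ∷ T) A B) (splits (e ∷ T) (length A))) ∎
    where
    open ≡-Reasoning
    minor : List (X ⊎ X) → ℚ
    minor = detRows (map joinRow T)
    rightSplits : List (List Bool × ℚ)
    rightSplits = map (toRight (length A)) (splits T (length A))
    leftSplits : List X → List (List Bool × ℚ)
    leftSplits []       = []
    leftSplits (_ ∷ A′) = map toLeft (splits T (length A′))
    splits-∷ : ∀ A → leftSplits A ++ map (toRight (length A)) (splits T (length A)) ≡ splits (e ∷ T) (length A)
    splits-∷ []      = refl
    splits-∷ (_ ∷ _) = refl
    leftBlock : ∀ A′ → A′ ≡ A → cofactorSum A′ (leftRow e) (λ W → minor (map inj₁ W ++ map inj₂ B)) 0
                                ≡ sumℚ (map (laplaceTerm (e ∷ T) A′ B) (leftSplits A′))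
    leftBlock []       _    = refl
    leftBlock (a ∷ A′) refl = expand-leftBlock e T (detRows-laplace T) a A′ B (ℕₚ.suc-injective len)

select-++ : ∀ v (T₁ T₂ : List E) bs₁ bs₂ → length bs₁ ≡ length T₁ →
  select v (T₁ ++ T₂) (bs₁ ++ bs₂) ≡ select v T₁ bs₁ ++ select v T₂ bs₂
select-++ v []       T₂ []        bs₂ e = refl
select-++ v (t ∷ T₁) T₂ (b ∷ bs₁) bs₂ e with b xor v
... | true  = select-++ v T₁ T₂ bs₁ bs₂ (ℕₚ.suc-injective e)
... | false = cong (t ∷_) (select-++ v T₁ T₂ bs₁ bs₂ (ℕₚ.suc-injective e))

select-All : ∀ {P : E → Set} v T bs → All P T → All P (select v T bs)
select-All v []      bs       Ps        = []
select-All v (e ∷ T) []       Ps        = []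
select-All v (e ∷ T) (b ∷ bs) (Pe ∷ Ps) with b xor v
... | true  = select-All v T bs Ps
... | false = Pe ∷ select-All v T bs Ps

countᵇ-select : ∀ (q : E → Bool) T bs → length bs ≡ length T →
  countᵇ q T ≡ countᵇ q (select true T bs) ℕ.+ countᵇ q (select false T bs)
countᵇ-select q []      []           e = refl
countᵇ-select q (t ∷ T) (true ∷ bs)  e with q t
... | true  = cong suc (countᵇ-select q T bs (ℕₚ.suc-injective e))
... | false = countᵇ-select q T bs (ℕₚ.suc-injective e)
countᵇ-select q (t ∷ T) (false ∷ bs) e with q t
... | true  = trans (cong suc (countᵇ-select q T bs (ℕₚ.suc-injective e))) (sym (ℕₚ.+-suc _ _))
... | false = countᵇ-select q T bs (ℕₚ.suc-injective e)

length-select : ∀ (T : List E) bs → length bs ≡ length T →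
  length (select true T bs) ≡ countᵇ id bs × length (select false T bs) ℕ.+ countᵇ id bs ≡ length T
length-select []      []           e = refl , refl
length-select (t ∷ T) (true ∷ bs)  e with length-select T bs (ℕₚ.suc-injective e)
... | e₁ , e₂ = cong suc e₁ , trans (ℕₚ.+-suc _ _) (cong suc e₂)
length-select (t ∷ T) (false ∷ bs) e with length-select T bs (ℕₚ.suc-injective e)
... | e₁ , e₂ = e₁ , cong suc e₂

countᵇ-select-< : ∀ (q : E → Bool) v T bs {e} → length bs ≡ length T → e ∈ select (not v) T bs → q e ≡ true →
  countᵇ q (select v T bs) ℕ.< countᵇ q T
countᵇ-select-< q true  T bs len e∈ qe =
  subst (countᵇ q (select true T bs) ℕ.<_) (sym (countᵇ-select q T bs len)) (ℕₚ.m<m+n _ (countᵇ-∈ q _ e∈ qe))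
countᵇ-select-< q false T bs len e∈ qe =
  subst (countᵇ q (select false T bs) ℕ.<_) (sym (countᵇ-select q T bs len)) (ℕₚ.m<n+m _ (countᵇ-∈ q _ e∈ qe))

IsSign : ℚ → Set
IsSign σ = σ ≡ 1ℚ ⊎ σ ≡ - 1ℚ

sgn-isSign : ∀ k → IsSign (sgn k)
sgn-isSign zero    = inj₁ refl
sgn-isSign (suc k) with sgn-isSign k
... | inj₁ e = inj₂ (cong -_ e)
... | inj₂ e = inj₁ (cong -_ e)

isSign-* : ∀ {σ τ} → IsSign σ → IsSign τ → IsSign (σ * τ)
isSign-* (inj₁ refl) (inj₁ refl) = inj₁ refl
isSign-* (inj₁ refl) (inj₂ refl) = inj₂ refl
isSign-* (inj₂ refl) (inj₁ refl) = inj₂ refl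
isSign-* (inj₂ refl) (inj₂ refl) = inj₁ refl

isSign⇒≢0 : ∀ {σ} → IsSign σ → σ ≢ 0ℚ
isSign⇒≢0 (inj₁ refl) ()
isSign⇒≢0 (inj₂ refl) ()

IsSplit : List E → ℕ → List Bool × ℚ → Set
IsSplit T k (bs , σ) = length bs ≡ length T × countᵇ id bs ≡ k × IsSign σ

splits-isSplit : ∀ (T : List E) k → All (IsSplit T k) (splits T k)
splits-isSplit []      zero    = (refl , refl , inj₁ refl) ∷ []
splits-isSplit []      (suc k) = []
splits-isSplit (e ∷ T) zero    =
  Allₚ.map⁺ (All.map (λ (l , c , ±) → cong suc l , c , isSign-* (sgn-isSign 0) ±) (splits-isSplit T zero))
splits-isSplit (e ∷ T) (suc k) = Allₚ.++⁺
  (Allₚ.map⁺ (All.map (λ (l , c , ±) → cong suc l , cong suc c , ±) (splits-isSplit T k)))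
  (Allₚ.map⁺ (All.map (λ (l , c , ±) → cong suc l , c , isSign-* (sgn-isSign (suc k)) ±) (splits-isSplit T (suc k))))

splits-distinct : ∀ (T : List E) k → AllPairs (λ s t → proj₁ s ≢ proj₁ t) (splits T k)
splits-distinct []      zero    = [] ∷ []
splits-distinct []      (suc k) = []
splits-distinct (e ∷ T) zero    = AllPairsₚ.map⁺ (AllPairs.map (λ ≢ → ≢ ∘ ∷-injectiveʳ) (splits-distinct T zero))
splits-distinct (e ∷ T) (suc k) = AllPairsₚ.++⁺
  (AllPairsₚ.map⁺ (AllPairs.map (λ ≢ → ≢ ∘ ∷-injectiveʳ) (splits-distinct T k)))
  (AllPairsₚ.map⁺ (AllPairs.map (λ ≢ → ≢ ∘ ∷-injectiveʳ) (splits-distinct T (suc k))))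
  (Allₚ.map⁺ (All.tabulate (λ _ → Allₚ.map⁺ (All.tabulate (λ _ ())))))

splits-complete : ∀ (T : List E) k bs → length bs ≡ length T → countᵇ id bs ≡ k → Σ ℚ λ σ → (bs , σ) ∈ splits T k
splits-complete []      zero    []           e c = 1ℚ , here refl
splits-complete (t ∷ T) zero    (false ∷ bs) e c with splits-complete T zero bs (ℕₚ.suc-injective e) c
... | σ , m = sgn 0 * σ , Memₚ.∈-map⁺ (toRight 0) m
splits-complete (t ∷ T) (suc k) (true ∷ bs)  e c with splits-complete T k bs (ℕₚ.suc-injective e) (ℕₚ.suc-injective c)
... | σ , m = σ , Memₚ.∈-++⁺ˡ (Memₚ.∈-map⁺ toLeft m)
splits-complete (t ∷ T) (suc k) (false ∷ bs) e c with splits-complete T (suc k) bs (ℕₚ.suc-injective e) c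
... | σ , m = sgn (suc k) * σ , Memₚ.∈-++⁺ʳ (map toLeft (splits T k)) (Memₚ.∈-map⁺ (toRight (suc k)) m)

module _ {n : ℕ} where

  atMost lessThan : Fin n → Fin n → Bool
  atMost   t r = does (r Finₚ.≤? t)
  lessThan t r = does (r Finₚ.<? t)

  lessThan⁻¹ : ∀ {t r} → lessThan t r ≡ true → r Fin.< t
  lessThan⁻¹ {t} {r} = dec-true⁻¹ (r Finₚ.<? t)

  allFin-increasing : AllPairs Fin._<_ (allFin n)
  allFin-increasing = AllPairsₚ.tabulate⁺-< id

  ∈-filterᵇ-allFin : ∀ (p : Fin n → Bool) {x} → p x ≡ true → x ∈ filterᵇ p (allFin n)
  ∈-filterᵇ-allFin p {x} px = Memₚ.∈-filter⁺ (T? ∘ p) (Memₚ.∈-allFin x) (Equivalence.from Boolₚ.T-≡ px)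

  filterᵇ-increasing : ∀ (p : Fin n → Bool) → AllPairs Fin._<_ (filterᵇ p (allFin n))
  filterᵇ-increasing p = AllPairsₚ.filter⁺ _ allFin-increasing

  countᵇ-atMost-above : ∀ (t x : Fin n) L → t Fin.< x → All (x Fin.<_) L → countᵇ (atMost t) L ≡ 0
  countᵇ-atMost-above t x L t<x x<L =
    countᵇ-none _ L (All.map (λ {z} x<z → dec-false (z Finₚ.≤? t) (ℕₚ.<⇒≱ (ℕₚ.<-trans t<x x<z))) x<L)

  ¬≤ₛ⇒threshold : ∀ (R C : List (Fin n)) → AllPairs Fin._<_ R → AllPairs Fin._<_ C → length R ≡ length C →
    ¬ R ≤ₛ C → Σ (Fin n) λ t → countᵇ (atMost t) R ℕ.< countᵇ (atMost t) C
  ¬≤ₛ⇒threshold []      []      _          _          _   R≰C = ⊥-elim (R≰C [])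
  ¬≤ₛ⇒threshold (r ∷ R) (c ∷ C) (r<R ∷ R↑) (c<C ∷ C↑) len R≰C with r Finₚ.≤? c
  ... | no r≰c = c , subst (ℕ._< countᵇ (atMost c) (c ∷ C)) (sym none-in-R) one-in-C
    where
    none-in-R : countᵇ (atMost c) (r ∷ R) ≡ 0
    none-in-R rewrite dec-false (r Finₚ.≤? c) r≰c = countᵇ-atMost-above c r R (ℕₚ.≰⇒> r≰c) r<R
    one-in-C : 0 ℕ.< countᵇ (atMost c) (c ∷ C)
    one-in-C rewrite dec-true (c Finₚ.≤? c) ℕₚ.≤-refl = s≤s z≤n
  ... | yes r≤c with ¬≤ₛ⇒threshold R C R↑ C↑ (ℕₚ.suc-injective len) (λ R≤C → R≰C (r≤c ∷ R≤C))
  ...   | t , fewer with c Finₚ.≤? t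
  ...     | yes c≤t = t , ℕₚ.≤-<-trans (countᵇ-∷-≤ (atMost t) r R)
                                         (subst (suc (countᵇ (atMost t) R) ℕ.<_) (sym c-counted) (s≤s fewer))
    where
    c-counted : countᵇ (atMost t) (c ∷ C) ≡ suc (countᵇ (atMost t) C)
    c-counted rewrite dec-true (c Finₚ.≤? t) c≤t = refl
  ...     | no c≰t = ⊥-elim (ℕₚ.n≮0 (subst (countᵇ (atMost t) R ℕ.<_) (countᵇ-atMost-above t c C (ℕₚ.≰⇒> c≰t) c<C) fewer))

  ≤ₛ-byCounting : ∀ (R C : List (Fin n)) → AllPairs Fin._<_ R → AllPairs Fin._<_ C → length R ≡ length C →
    (∀ t → countᵇ (atMost t) C ℕ.≤ countᵇ (atMost t) R) → R ≤ₛ C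
  ≤ₛ-byCounting R C R↑ C↑ len counts with Pointwiseₚ.decidable Finₚ._≤?_ R C
  ... | yes R≤C = R≤C
  ... | no R≰C with ¬≤ₛ⇒threshold R C R↑ C↑ len R≰C
  ...   | t , fewer = ⊥-elim (ℕₚ.<⇒≱ fewer (counts t))

  Yentry-below : ∀ y r s → s Fin.< r → Yentry {n} y r s ≡ 0ℚ
  Yentry-below y r s s<r rewrite dec-false (r Finₚ.≤? s) (ℕₚ.<⇒≱ s<r) = refl

  det-subY : ∀ y R C → det (subY {n} y R C) ≡ detRows (map (Yentry y) R) C
  det-subY y R C = cong₂ detN (trans (length-map _ R) (sym (length-map (Yentry y) R))) (map-∘ R)

  det-subY-unless-≤ₛ : ∀ y R C → AllPairs Fin._<_ R → AllPairs Fin._<_ C → length R ≡ length C →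
    ¬ R ≤ₛ C → det (subY {n} y R C) ≡ 0ℚ
  det-subY-unless-≤ₛ y R C R↑ C↑ len R≰C with ¬≤ₛ⇒threshold R C R↑ C↑ len R≰C
  ... | t , fewer = trans (det-subY y R C)
    (detRows-fewSupportingRows (Yentry y) (atMost t) (atMost t) R C len fewer
      (All.tabulate (λ {r} _ r≰t c c≤t →
        Yentry-below y r c (ℕₚ.≤-<-trans (dec-true⁻¹ (c Finₚ.≤? t) c≤t) (ℕₚ.≰⇒> (dec-false⁻¹ (r Finₚ.≤? t) r≰t))))))

module _ {n : ℕ} where

  _∈ᵇ_ : Fin n → List (Fin n) → Bool
  x ∈ᵇ L = does (Any.any? (x Finₚ.≟_) L)

  increasing-unique : ∀ {xs ys : List (Fin n)} → AllPairs Fin._<_ xs → AllPairs Fin._<_ ys →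
    (∀ {z} → z ∈ xs → z ∈ ys) → (∀ {z} → z ∈ ys → z ∈ xs) → xs ≡ ys
  increasing-unique {[]}     {[]}     _ _ _ _ = refl
  increasing-unique {[]}     {y ∷ ys} _ _ _ ys⊆xs with ys⊆xs (here refl)
  ... | ()
  increasing-unique {x ∷ xs} {[]}     _ _ xs⊆ys _ with xs⊆ys (here refl)
  ... | ()
  increasing-unique {x ∷ xs} {y ∷ ys} (x<xs ∷ xs↑) (y<ys ∷ ys↑) xs⊆ys ys⊆xs =
    cong₂ _∷_ x≡y (increasing-unique xs↑ ys↑ tail⊆ tail⊇)
    where
    x≡y : x ≡ y
    x≡y with xs⊆ys (here refl) | ys⊆xs (here refl)
    ... | here x≡y   | _          = x≡y
    ... | there _    | here y≡x   = sym y≡x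
    ... | there x∈ys | there y∈xs = ⊥-elim (ℕₚ.<-asym (All.lookup y<ys x∈ys) (All.lookup x<xs y∈xs))
    tail⊆ : ∀ {z} → z ∈ xs → z ∈ ys
    tail⊆ z∈xs with xs⊆ys (there z∈xs)
    ... | here refl  = ⊥-elim (ℕₚ.<-irrefl (cong toℕ x≡y) (All.lookup x<xs z∈xs))
    ... | there z∈ys = z∈ys
    tail⊇ : ∀ {z} → z ∈ ys → z ∈ xs
    tail⊇ z∈ys with ys⊆xs (there z∈ys)
    ... | here refl  = ⊥-elim (ℕₚ.<-irrefl (cong toℕ (sym x≡y)) (All.lookup y<ys z∈ys))
    ... | there z∈xs = z∈xs

  filterᵇ-∈ᵇ : ∀ L → AllPairs Fin._<_ L → filterᵇ (_∈ᵇ L) (allFin n) ≡ L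
  filterᵇ-∈ᵇ L L↑ = increasing-unique (filterᵇ-increasing (_∈ᵇ L)) L↑
    (λ {z} z∈ → dec-true⁻¹ (Any.any? (z Finₚ.≟_) L)
                   (Equivalence.to Boolₚ.T-≡ (proj₂ (Memₚ.∈-filter⁻ (T? ∘ (_∈ᵇ L)) {xs = allFin n} z∈))))
    (λ {z} z∈L → ∈-filterᵇ-allFin (_∈ᵇ L) (dec-true (Any.any? (z Finₚ.≟_) L) z∈L))

  setColumn : Diagram n → Fin n → List (Fin n) → Diagram n
  setColumn D j L x j′ = if does (j′ Finₚ.≟ j) then x ∈ᵇ L else D x j′

  col-setColumn : ∀ D j L → AllPairs Fin._<_ L → col (setColumn D j L) j ≡ L
  col-setColumn D j L L↑ =
    trans (filterᵇ-cong (allFin n)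
             (All.tabulate (λ {x} _ → cong (λ b → if b then x ∈ᵇ L else D x j) (dec-true (j Finₚ.≟ j) refl))))
          (filterᵇ-∈ᵇ L L↑)

  col-setColumn-≢ : ∀ D j L j′ → j′ ≢ j → col (setColumn D j L) j′ ≡ col D j′
  col-setColumn-≢ D j L j′ j′≢j =
    filterᵇ-cong (allFin n)
      (All.tabulate (λ {x} _ → cong (λ b → if b then x ∈ᵇ L else D x j′) (dec-false (j′ Finₚ.≟ j) j′≢j)))

  col-setColumn-≤ₛ : ∀ C D j L → AllPairs Fin._<_ L → L ≤ₛ col D j → (∀ j′ → j′ ≢ j → col C j′ ≤ₛ col D j′) →
    setColumn C j L ≤D D
  col-setColumn-≤ₛ C D j L L↑ L≤ others j′ = by-cases (j′ Finₚ.≟ j)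
    where
    by-cases : Dec (j′ ≡ j) → col (setColumn C j L) j′ ≤ₛ col D j′
    by-cases (yes refl) = subst (_≤ₛ col D j) (sym (col-setColumn C j L L↑)) L≤
    by-cases (no j′≢j)  = subst (_≤ₛ col D j′) (sym (col-setColumn-≢ C j L j′ j′≢j)) (others j′ j′≢j)

-- The auxiliary matrix

data Role : Set where
  left right shared : Role

Entry : ℕ → Set
Entry n = Fin n × Role

label : ∀ {n} → Entry n → Fin n
label = proj₁

labels : ∀ {n} → List (Entry n) → List (Fin n)
labels = map label

rowEntries : ∀ {n} → Fin n → (inWindow inA inB : Bool) → List (Entry n)
rowEntries x true  a b = (x , shared) ∷ []
rowEntries x false a b = (if a then (x , left) ∷ [] else []) ++ (if b then (x , right) ∷ [] else [])

fits : Role → Bool → Bool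
fits left   b = b
fits right  b = not b
fits shared b = true

admissible : ∀ {n} → List (Entry n) → List Bool → Bool
admissible (e ∷ T) (b ∷ bs) = fits (proj₂ e) b ∧ admissible T bs
admissible _       _        = true

split-along : ∀ (T₁ T₂ : List A) (bs : List B) → length bs ≡ length (T₁ ++ T₂) →
  Σ[ bs₁ ∈ List B ] Σ[ bs₂ ∈ List B ] bs ≡ bs₁ ++ bs₂ × length bs₁ ≡ length T₁ × length bs₂ ≡ length T₂
split-along []       T₂ bs       e = [] , bs , refl , refl , e
split-along (t ∷ T₁) T₂ (b ∷ bs) e with split-along T₁ T₂ bs (ℕₚ.suc-injective e)
... | bs₁ , bs₂ , refl , l₁ , l₂ = b ∷ bs₁ , bs₂ , refl , cong suc l₁ , l₂

module _ {n : ℕ} where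

  admissible-++⁻ : ∀ (T₁ T₂ : List (Entry n)) bs₁ bs₂ → length bs₁ ≡ length T₁ →
    admissible (T₁ ++ T₂) (bs₁ ++ bs₂) ≡ true → admissible T₁ bs₁ ≡ true × admissible T₂ bs₂ ≡ true
  admissible-++⁻ []       T₂ []        bs₂ _ adm = refl , adm
  admissible-++⁻ (t ∷ T₁) T₂ (b ∷ bs₁) bs₂ l adm with ∧-true⁻¹ adm
  ... | fits-t , adm-rest with admissible-++⁻ T₁ T₂ bs₁ bs₂ (ℕₚ.suc-injective l) adm-rest
  ...   | adm₁ , adm₂ = cong₂ _∧_ fits-t adm₁ , adm₂

  labels-select-++ : ∀ v (T₁ T₂ : List (Entry n)) bs₁ bs₂ → length bs₁ ≡ length T₁ →
    labels (select v (T₁ ++ T₂) (bs₁ ++ bs₂)) ≡ labels (select v T₁ bs₁) ++ labels (select v T₂ bs₂)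
  labels-select-++ v T₁ T₂ bs₁ bs₂ l =
    trans (cong labels (select-++ v T₁ T₂ bs₁ bs₂ l)) (map-++ label (select v T₁ bs₁) (select v T₂ bs₂))

  rowEntries-label : ∀ (x : Fin n) w a b → All (λ e → label e ≡ x) (rowEntries x w a b)
  rowEntries-label x true  a     b     = refl ∷ []
  rowEntries-label x false true  true  = refl ∷ refl ∷ []
  rowEntries-label x false true  false = refl ∷ []
  rowEntries-label x false false true  = refl ∷ []
  rowEntries-label x false false false = []

  select-rowEntries : ∀ v (x : Fin n) w a b bs → length bs ≡ length (rowEntries x w a b) →
    admissible (rowEntries x w a b) bs ≡ true →
    labels (select v (rowEntries x w a b) bs) ≡ [] ⊎ labels (select v (rowEntries x w a b) bs) ≡ [ x ]
  select-rowEntries true  x true  a     b     (true  ∷ [])         _ _ = inj₂ refl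
  select-rowEntries true  x true  a     b     (false ∷ [])         _ _ = inj₁ refl
  select-rowEntries false x true  a     b     (true  ∷ [])         _ _ = inj₁ refl
  select-rowEntries false x true  a     b     (false ∷ [])         _ _ = inj₂ refl
  select-rowEntries true  x false true  true  (true ∷ false ∷ [])  _ _ = inj₂ refl
  select-rowEntries false x false true  true  (true ∷ false ∷ [])  _ _ = inj₂ refl
  select-rowEntries true  x false true  false (true  ∷ [])         _ _ = inj₂ refl
  select-rowEntries false x false true  false (true  ∷ [])         _ _ = inj₁ refl
  select-rowEntries true  x false false true  (false ∷ [])         _ _ = inj₁ refl
  select-rowEntries false x false false true  (false ∷ [])         _ _ = inj₂ refl
  select-rowEntries v     x false false false []                   _ _ = inj₁ refl

  select-rowEntries-injective : ∀ (x : Fin n) w a b bs cs →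
    length bs ≡ length (rowEntries x w a b) → length cs ≡ length (rowEntries x w a b) →
    admissible (rowEntries x w a b) bs ≡ true → admissible (rowEntries x w a b) cs ≡ true →
    labels (select true (rowEntries x w a b) bs) ≡ labels (select true (rowEntries x w a b) cs) → bs ≡ cs
  select-rowEntries-injective x true  a     b     (true  ∷ []) (true  ∷ []) _ _ _ _ _ = refl
  select-rowEntries-injective x true  a     b     (false ∷ []) (false ∷ []) _ _ _ _ _ = refl
  select-rowEntries-injective x true  a     b     (true  ∷ []) (false ∷ []) _ _ _ _ ()
  select-rowEntries-injective x true  a     b     (false ∷ []) (true  ∷ []) _ _ _ _ ()
  select-rowEntries-injective x false true  true  (true ∷ false ∷ []) (true ∷ false ∷ []) _ _ _ _ _ = refl
  select-rowEntries-injective x false true  false (true  ∷ []) (true  ∷ []) _ _ _ _ _ = refl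
  select-rowEntries-injective x false false true  (false ∷ []) (false ∷ []) _ _ _ _ _ = refl
  select-rowEntries-injective x false false false []           []           _ _ _ _ _ = refl

onLeft onRight : ∀ {n} → (Fin n → Bool) → Entry n → Bool
onLeft  p (x , left)  = p x
onLeft  p _           = false
onRight p (x , right) = p x
onRight p _           = false

countᵇ-onLeft-rowEntries : ∀ {n} (p : Fin n → Bool) x w a b →
  countᵇ (onLeft p) (rowEntries x w a b) ≡ indicator (not w ∧ a ∧ p x)
countᵇ-onLeft-rowEntries p x true  a     b     = refl
countᵇ-onLeft-rowEntries p x false true  true  with p x
... | true  = refl
... | false = refl
countᵇ-onLeft-rowEntries p x false true  false with p x
... | true  = refl
... | false = refl
countᵇ-onLeft-rowEntries p x false false true  = refl
countᵇ-onLeft-rowEntries p x false false false = refl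

countᵇ-onRight-rowEntries : ∀ {n} (p : Fin n → Bool) x w a b →
  countᵇ (onRight p) (rowEntries x w a b) ≡ indicator (not w ∧ b ∧ p x)
countᵇ-onRight-rowEntries p x true  a     b     = refl
countᵇ-onRight-rowEntries p x false true  true  with p x
... | true  = refl
... | false = refl
countᵇ-onRight-rowEntries p x false false true  with p x
... | true  = refl
... | false = refl
countᵇ-onRight-rowEntries p x false true  false = refl
countᵇ-onRight-rowEntries p x false false false = refl

Misplaced : ∀ {n} → List (Entry n) → List Bool → Set
Misplaced {n} T bs = Σ[ x ∈ Fin n ] ((x , left) ∈ select false T bs ⊎ (x , right) ∈ select true T bs)

misplaced-∷ : ∀ {n} (e : Entry n) b T bs → Misplaced T bs → Misplaced (e ∷ T) (b ∷ bs)
misplaced-∷ e true  T bs (x , inj₁ m) = x , inj₁ m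
misplaced-∷ e true  T bs (x , inj₂ m) = x , inj₂ (there m)
misplaced-∷ e false T bs (x , inj₁ m) = x , inj₁ (there m)
misplaced-∷ e false T bs (x , inj₂ m) = x , inj₂ m

misplaced : ∀ {n} (T : List (Entry n)) bs → length bs ≡ length T → admissible T bs ≡ false → Misplaced T bs
misplaced ((x , left)   ∷ T) (false ∷ bs) _   _   = x , inj₁ (here refl)
misplaced ((x , right)  ∷ T) (true  ∷ bs) _   _   = x , inj₂ (here refl)
misplaced ((x , left)   ∷ T) (true  ∷ bs) len adm = misplaced-∷ _ true  T bs (misplaced T bs (ℕₚ.suc-injective len) adm)
misplaced ((x , right)  ∷ T) (false ∷ bs) len adm = misplaced-∷ _ false T bs (misplaced T bs (ℕₚ.suc-injective len) adm)
misplaced ((x , shared) ∷ T) (b     ∷ bs) len adm = misplaced-∷ _ b     T bs (misplaced T bs (ℕₚ.suc-injective len) adm)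

record NormalPattern {n} (D : Diagram n) : Set where
  field
    i₁ i₂ j₁ j₂ : Fin n
    i₁<i₂  : i₁ Fin.< i₂
    j₁≢j₂  : j₁ ≢ j₂
    i₁∉D₁  : D i₁ j₁ ≡ false
    i₁∉D₂  : D i₁ j₂ ≡ false
    i₂∈D₁  : D i₂ j₁ ≡ true
    i₂∈D₂  : D i₂ j₂ ≡ true
    window : ∀ x → i₁ Fin.< x → x Fin.< i₂ → D x j₁ ≡ not (D x j₂)

-- Any row strictly between i₁ and i₂ lying in both or in neither column can replace i₂ or i₁.
normalise-within : ∀ {n} (D : Diagram n) k {i₁ i₂ j₁ j₂} → toℕ i₂ ℕ.≤ toℕ i₁ ℕ.+ k → i₁ Fin.< i₂ → j₁ ≢ j₂ →
  D i₁ j₁ ≡ false → D i₁ j₂ ≡ false → D i₂ j₁ ≡ true → D i₂ j₂ ≡ true → NormalPattern D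
normalise-within D zero    i₂≤i₁+0 i₁<i₂ = ⊥-elim (ℕₚ.<⇒≱ i₁<i₂ (subst (_ ℕ.≤_) (ℕₚ.+-identityʳ _) i₂≤i₁+0))
normalise-within D (suc k) {i₁} {i₂} {j₁} {j₂} i₂≤i₁+k i₁<i₂ j₁≢j₂ i₁∉D₁ i₁∉D₂ i₂∈D₁ i₂∈D₂
  with Finₚ.any? (λ x → (i₁ Finₚ.<? x) ×-dec (x Finₚ.<? i₂) ×-dec (D x j₁ Boolₚ.≟ D x j₂))
... | no none-between = record
  { i₁ = i₁ ; i₂ = i₂ ; j₁ = j₁ ; j₂ = j₂ ; i₁<i₂ = i₁<i₂ ; j₁≢j₂ = j₁≢j₂
  ; i₁∉D₁ = i₁∉D₁ ; i₁∉D₂ = i₁∉D₂ ; i₂∈D₁ = i₂∈D₁ ; i₂∈D₂ = i₂∈D₂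
  ; window = λ x i₁<x x<i₂ → Boolₚ.¬-not (λ same → none-between (x , i₁<x , x<i₂ , same)) }
... | yes (x , i₁<x , x<i₂ , same) with D x j₁ in Dxj₁
...   | true  = normalise-within D k (ℕₚ.≤-pred (ℕₚ.≤-trans x<i₂ (subst (toℕ i₂ ℕ.≤_) (ℕₚ.+-suc (toℕ i₁) k) i₂≤i₁+k)))
                                 i₁<x j₁≢j₂ i₁∉D₁ i₁∉D₂ Dxj₁ (sym same)
...   | false = normalise-within D k (ℕₚ.≤-trans (subst (toℕ i₂ ℕ.≤_) (ℕₚ.+-suc (toℕ i₁) k) i₂≤i₁+k) (ℕₚ.+-monoˡ-≤ k i₁<x))
                                 x<i₂ j₁≢j₂ Dxj₁ (sym same) i₂∈D₁ i₂∈D₂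

normalise : ∀ {n} (D : Diagram n) → HasPattern D → NormalPattern D
normalise D (i₁ , i₂ , j₁ , j₂ , i₁<i₂ , j₁<j₂ , i₁∉D₁ , i₁∉D₂ , i₂∈D₁ , i₂∈D₂) =
  normalise-within D (toℕ i₂) (ℕₚ.m≤n+m (toℕ i₂) (toℕ i₁)) i₁<i₂ (λ j₁≡j₂ → ℕₚ.<-irrefl (cong toℕ j₁≡j₂) j₁<j₂)
                   i₁∉D₁ i₁∉D₂ i₂∈D₁ i₂∈D₂

module Pattern {n : ℕ} (D : Diagram n) (P : NormalPattern D) where

  open NormalPattern P

  in₁ in₂ inWindow : Fin n → Bool
  in₁ x = D x j₁
  in₂ x = D x j₂
  inWindow x = atMost x i₁ ∧ atMost i₂ x

  D₁ D₂ : List (Fin n)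
  D₁ = col D j₁
  D₂ = col D j₂

  entriesAt : Fin n → List (Entry n)
  entriesAt x = rowEntries x (inWindow x) (in₁ x) (in₂ x)

  entriesFrom : List (Fin n) → List (Entry n)
  entriesFrom = concatMap entriesAt

  entries : List (Entry n)
  entries = entriesFrom (allFin n)

  data Position (x : Fin n) : Set where
    at-i₁   : x ≡ i₁ → Position x
    at-i₂   : x ≡ i₂ → Position x
    between : i₁ Fin.< x → x Fin.< i₂ → Position x
    below   : x Fin.< i₁ → Position x
    above   : i₂ Fin.< x → Position x

  position : ∀ x → Position x
  position x with Finₚ.<-cmp x i₁
  ... | tri< x<i₁ _ _ = below x<i₁
  ... | tri≈ _ x≡i₁ _ = at-i₁ x≡i₁
  ... | tri> _ _ i₁<x with Finₚ.<-cmp x i₂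
  ...   | tri< x<i₂ _ _ = between i₁<x x<i₂
  ...   | tri≈ _ x≡i₂ _ = at-i₂ x≡i₂
  ...   | tri> _ _ i₂<x = above i₂<x

  inWindow-inside : ∀ {x} → i₁ Fin.≤ x → x Fin.≤ i₂ → inWindow x ≡ true
  inWindow-inside {x} i₁≤x x≤i₂ = cong₂ _∧_ (dec-true (i₁ Finₚ.≤? x) i₁≤x) (dec-true (x Finₚ.≤? i₂) x≤i₂)

  inWindow-below : ∀ {x} → x Fin.< i₁ → inWindow x ≡ false
  inWindow-below {x} x<i₁ = cong (_∧ atMost i₂ x) (dec-false (i₁ Finₚ.≤? x) (ℕₚ.<⇒≱ x<i₁))

  inWindow-above : ∀ {x} → i₂ Fin.< x → inWindow x ≡ false
  inWindow-above {x} i₂<x = trans (cong (atMost x i₁ ∧_) (dec-false (x Finₚ.≤? i₂) (ℕₚ.<⇒≱ i₂<x))) (Boolₚ.∧-zeroʳ _)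

  Outside : Fin n → Set
  Outside x = x Fin.< i₁ ⊎ i₂ Fin.< x

  Placed : Entry n → Set
  Placed (x , shared) = i₁ Fin.≤ x × x Fin.≤ i₂
  Placed (x , left)   = Outside x × in₁ x ≡ true
  Placed (x , right)  = Outside x × in₂ x ≡ true

  outside-placed : ∀ x → Outside x → ∀ a b → in₁ x ≡ a → in₂ x ≡ b → All Placed (rowEntries x false a b)
  outside-placed x out true  true  a b = (out , a) ∷ (out , b) ∷ []
  outside-placed x out true  false a b = (out , a) ∷ []
  outside-placed x out false true  a b = (out , b) ∷ []
  outside-placed x out false false a b = []

  entriesAt-placed : ∀ x → All Placed (entriesAt x)
  entriesAt-placed x with position x
  ... | at-i₁ refl          rewrite inWindow-inside (ℕₚ.≤-refl {toℕ i₁}) (ℕₚ.<⇒≤ i₁<i₂) = (ℕₚ.≤-refl , ℕₚ.<⇒≤ i₁<i₂) ∷ []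
  ... | at-i₂ refl          rewrite inWindow-inside (ℕₚ.<⇒≤ i₁<i₂) (ℕₚ.≤-refl {toℕ i₂}) = (ℕₚ.<⇒≤ i₁<i₂ , ℕₚ.≤-refl) ∷ []
  ... | between i₁<x x<i₂  rewrite inWindow-inside (ℕₚ.<⇒≤ i₁<x) (ℕₚ.<⇒≤ x<i₂)         = (ℕₚ.<⇒≤ i₁<x , ℕₚ.<⇒≤ x<i₂) ∷ []
  ... | below x<i₁          rewrite inWindow-below x<i₁ = outside-placed x (inj₁ x<i₁) (in₁ x) (in₂ x) refl refl
  ... | above i₂<x          rewrite inWindow-above i₂<x = outside-placed x (inj₂ i₂<x) (in₁ x) (in₂ x) refl refl

  entriesFrom-placed : ∀ xs → All Placed (entriesFrom xs)
  entriesFrom-placed []       = []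
  entriesFrom-placed (x ∷ xs) = Allₚ.++⁺ (entriesAt-placed x) (entriesFrom-placed xs)

  entriesFrom-label : ∀ (P : Fin n → Set) xs → All P xs → All (P ∘ label) (entriesFrom xs)
  entriesFrom-label P []       []         = []
  entriesFrom-label P (x ∷ xs) (px ∷ pxs) =
    Allₚ.++⁺ (All.map (λ e≡x → subst P (sym e≡x) px) (rowEntries-label x (inWindow x) (in₁ x) (in₂ x)))
             (entriesFrom-label P xs pxs)

  selected-above : ∀ v (x : Fin n) xs bs → All (x Fin.<_) xs → All (x Fin.<_) (labels (select v (entriesFrom xs) bs))
  selected-above v x xs bs x<xs = Allₚ.map⁺ (select-All v (entriesFrom xs) bs (entriesFrom-label (x Fin.<_) xs x<xs))

  selected-increasing : ∀ v xs bs → AllPairs Fin._<_ xs → length bs ≡ length (entriesFrom xs) →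
    admissible (entriesFrom xs) bs ≡ true → AllPairs Fin._<_ (labels (select v (entriesFrom xs) bs))
  selected-increasing v []       bs _             _   _   = []
  selected-increasing v (x ∷ xs) bs (x<xs ∷ xs↑) len adm with split-along (entriesAt x) (entriesFrom xs) bs len
  ... | bs₁ , bs₂ , refl , l₁ , l₂ =
    subst (AllPairs Fin._<_) (sym (labels-select-++ v (entriesAt x) (entriesFrom xs) bs₁ bs₂ l₁))
          (prepend (select-rowEntries v x (inWindow x) (in₁ x) (in₂ x) bs₁ l₁ (proj₁ adm′)))
    where
    adm′ : admissible (entriesAt x) bs₁ ≡ true × admissible (entriesFrom xs) bs₂ ≡ true
    adm′ = admissible-++⁻ (entriesAt x) (entriesFrom xs) bs₁ bs₂ l₁ adm
    rest : List (Fin n)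
    rest = labels (select v (entriesFrom xs) bs₂)
    prepend : ∀ {L} → L ≡ [] ⊎ L ≡ [ x ] → AllPairs Fin._<_ (L ++ rest)
    prepend (inj₁ refl) = selected-increasing v xs bs₂ xs↑ l₂ (proj₂ adm′)
    prepend (inj₂ refl) = selected-above v x xs bs₂ x<xs ∷ selected-increasing v xs bs₂ xs↑ l₂ (proj₂ adm′)

  selected-injective : ∀ xs bs cs → AllPairs Fin._<_ xs →
    length bs ≡ length (entriesFrom xs) → length cs ≡ length (entriesFrom xs) →
    admissible (entriesFrom xs) bs ≡ true → admissible (entriesFrom xs) cs ≡ true →
    labels (select true (entriesFrom xs) bs) ≡ labels (select true (entriesFrom xs) cs) → bs ≡ cs
  selected-injective []       [] [] _             _    _    _    _    _ = refl
  selected-injective (x ∷ xs) bs cs (x<xs ∷ xs↑) lenb lenc admb admc eq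
    with split-along (entriesAt x) (entriesFrom xs) bs lenb | split-along (entriesAt x) (entriesFrom xs) cs lenc
  ... | bs₁ , bs₂ , refl , lb₁ , lb₂ | cs₁ , cs₂ , refl , lc₁ , lc₂ =
    cong₂ _++_ (select-rowEntries-injective x (inWindow x) (in₁ x) (in₂ x) bs₁ cs₁ lb₁ lc₁
                                            (proj₁ admb′) (proj₁ admc′) (proj₁ heads≡))
               (selected-injective xs bs₂ cs₂ xs↑ lb₂ lc₂ (proj₂ admb′) (proj₂ admc′) (proj₂ heads≡))
    where
    admb′ : admissible (entriesAt x) bs₁ ≡ true × admissible (entriesFrom xs) bs₂ ≡ true
    admb′ = admissible-++⁻ (entriesAt x) (entriesFrom xs) bs₁ bs₂ lb₁ admb
    admc′ : admissible (entriesAt x) cs₁ ≡ true × admissible (entriesFrom xs) cs₂ ≡ true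
    admc′ = admissible-++⁻ (entriesAt x) (entriesFrom xs) cs₁ cs₂ lc₁ admc
    Lb Lc Rb Rc : List (Fin n)
    Lb = labels (select true (entriesAt x) bs₁)
    Lc = labels (select true (entriesAt x) cs₁)
    Rb = labels (select true (entriesFrom xs) bs₂)
    Rc = labels (select true (entriesFrom xs) cs₂)
    x∉ : ∀ {L L′} → All (x Fin.<_) L → L ≢ x ∷ L′
    x∉ (x<x ∷ _) refl = ℕₚ.<-irrefl refl x<x
    split-heads : Lb ≡ [] ⊎ Lb ≡ [ x ] → Lc ≡ [] ⊎ Lc ≡ [ x ] → Lb ++ Rb ≡ Lc ++ Rc → Lb ≡ Lc × Rb ≡ Rc
    split-heads (inj₁ p) (inj₁ q) e rewrite p | q = refl , e
    split-heads (inj₂ p) (inj₂ q) e rewrite p | q = refl , proj₂ (∷-injective e)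
    split-heads (inj₁ p) (inj₂ q) e rewrite p | q = ⊥-elim (x∉ (selected-above true x xs bs₂ x<xs) e)
    split-heads (inj₂ p) (inj₁ q) e rewrite p | q = ⊥-elim (x∉ (selected-above true x xs cs₂ x<xs) (sym e))
    heads≡ : Lb ≡ Lc × Rb ≡ Rc
    heads≡ = split-heads (select-rowEntries true x (inWindow x) (in₁ x) (in₂ x) bs₁ lb₁ (proj₁ admb′))
                         (select-rowEntries true x (inWindow x) (in₁ x) (in₂ x) cs₁ lc₁ (proj₁ admc′))
                         (trans (sym (labels-select-++ true (entriesAt x) (entriesFrom xs) bs₁ bs₂ lb₁))
                                (trans eq (labels-select-++ true (entriesAt x) (entriesFrom xs) cs₁ cs₂ lc₁)))

  -- The split whose diagram has columns D₁ and D₂′ = D₂ with i₂ replaced by i₁; its coefficient is ±1.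
  bit₀ : Entry n → Bool
  bit₀ (x , left)   = true
  bit₀ (x , right)  = false
  bit₀ (x , shared) = in₁ x

  bits₀ : List Bool
  bits₀ = map bit₀ entries

  admissible-map-bit₀ : ∀ T → admissible T (map bit₀ T) ≡ true
  admissible-map-bit₀ []                 = refl
  admissible-map-bit₀ ((x , left)   ∷ T) = admissible-map-bit₀ T
  admissible-map-bit₀ ((x , right)  ∷ T) = admissible-map-bit₀ T
  admissible-map-bit₀ ((x , shared) ∷ T) = admissible-map-bit₀ T

  in₂′ : Fin n → Bool
  in₂′ x = if inWindow x then not (in₁ x) else in₂ x

  D₂′ : List (Fin n)
  D₂′ = filterᵇ in₂′ (allFin n)

  select₀-rowEntries : ∀ x w a b → in₁ x ≡ a →
      labels (select true  (rowEntries x w a b) (map bit₀ (rowEntries x w a b))) ≡ (if a then [ x ] else [])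
    × labels (select false (rowEntries x w a b) (map bit₀ (rowEntries x w a b)))
      ≡ (if (if w then not a else b) then [ x ] else [])
  select₀-rowEntries x true  true  b     e rewrite e = refl , refl
  select₀-rowEntries x true  false b     e rewrite e = refl , refl
  select₀-rowEntries x false true  true  e = refl , refl
  select₀-rowEntries x false true  false e = refl , refl
  select₀-rowEntries x false false true  e = refl , refl
  select₀-rowEntries x false false false e = refl , refl

  select₀ : ∀ v (q : Fin n → Bool) →
    (∀ x → labels (select v (entriesAt x) (map bit₀ (entriesAt x))) ≡ (if q x then [ x ] else [])) →
    ∀ xs → labels (select v (entriesFrom xs) (map bit₀ (entriesFrom xs))) ≡ filterᵇ q xs
  select₀ v q row []       = refl
  select₀ v q row (x ∷ xs) = begin
    labels (select v (entriesAt x ++ entriesFrom xs) (map bit₀ (entriesAt x ++ entriesFrom xs)))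
      ≡⟨ cong (λ bs → labels (select v (entriesAt x ++ entriesFrom xs) bs)) (map-++ bit₀ (entriesAt x) (entriesFrom xs)) ⟩
    labels (select v (entriesAt x ++ entriesFrom xs) (map bit₀ (entriesAt x) ++ map bit₀ (entriesFrom xs)))
      ≡⟨ labels-select-++ v (entriesAt x) (entriesFrom xs) _ _ (length-map bit₀ (entriesAt x)) ⟩
    labels (select v (entriesAt x) (map bit₀ (entriesAt x)))
      ++ labels (select v (entriesFrom xs) (map bit₀ (entriesFrom xs)))
      ≡⟨ cong₂ _++_ (row x) (select₀ v q row xs) ⟩
    (if q x then [ x ] else []) ++ filterᵇ q xs
      ≡⟨ prepend ⟩
    filterᵇ q (x ∷ xs) ∎
    where
    open ≡-Reasoning
    prepend : (if q x then [ x ] else []) ++ filterᵇ q xs ≡ filterᵇ q (x ∷ xs)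
    prepend with q x
    ... | true  = refl
    ... | false = refl

  labels₀-left : labels (select true entries bits₀) ≡ D₁
  labels₀-left = select₀ true in₁ (λ x → proj₁ (select₀-rowEntries x (inWindow x) (in₁ x) (in₂ x) refl)) (allFin n)

  labels₀-right : labels (select false entries bits₀) ≡ D₂′
  labels₀-right = select₀ false in₂′ (λ x → proj₂ (select₀-rowEntries x (inWindow x) (in₁ x) (in₂ x) refl)) (allFin n)

  i₁≢i₂ : i₁ ≢ i₂
  i₁≢i₂ i₁≡i₂ = ℕₚ.<-irrefl (cong toℕ i₁≡i₂) i₁<i₂

  in₂′-exchange : ∀ (r : Fin n → Bool) x →
    indicator (in₂′ x ∧ r x) ℕ.+ indicator (does (x Finₚ.≟ i₂) ∧ r x)
    ≡ indicator (in₂ x ∧ r x) ℕ.+ indicator (does (x Finₚ.≟ i₁) ∧ r x)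
  in₂′-exchange r x with position x
  ... | at-i₁ refl rewrite inWindow-inside (ℕₚ.≤-refl {toℕ i₁}) (ℕₚ.<⇒≤ i₁<i₂) | i₁∉D₁ | i₁∉D₂
                         | dec-true (i₁ Finₚ.≟ i₁) refl | dec-false (i₁ Finₚ.≟ i₂) i₁≢i₂
                         = ℕₚ.+-comm (indicator (r i₁)) 0
  ... | at-i₂ refl rewrite inWindow-inside (ℕₚ.<⇒≤ i₁<i₂) (ℕₚ.≤-refl {toℕ i₂}) | i₂∈D₁ | i₂∈D₂
                         | dec-true (i₂ Finₚ.≟ i₂) refl | dec-false (i₂ Finₚ.≟ i₁) (i₁≢i₂ ∘ sym)
                         = ℕₚ.+-comm 0 (indicator (r i₂))
  ... | between i₁<x x<i₂ rewrite inWindow-inside (ℕₚ.<⇒≤ i₁<x) (ℕₚ.<⇒≤ x<i₂) | window x i₁<x x<i₂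
                               | Boolₚ.not-involutive (in₂ x)
                               | dec-false (x Finₚ.≟ i₁) (λ x≡i₁ → ℕₚ.<-irrefl (cong toℕ (sym x≡i₁)) i₁<x)
                               | dec-false (x Finₚ.≟ i₂) (λ x≡i₂ → ℕₚ.<-irrefl (cong toℕ x≡i₂) x<i₂) = refl
  ... | below x<i₁ rewrite inWindow-below x<i₁
                         | dec-false (x Finₚ.≟ i₁) (λ x≡i₁ → ℕₚ.<-irrefl (cong toℕ x≡i₁) x<i₁)
                         | dec-false (x Finₚ.≟ i₂) (λ x≡i₂ → ℕₚ.<-irrefl (cong toℕ x≡i₂) (ℕₚ.<-trans x<i₁ i₁<i₂)) = refl
  ... | above i₂<x rewrite inWindow-above i₂<x
                         | dec-false (x Finₚ.≟ i₁) (λ x≡i₁ → ℕₚ.<-irrefl (cong toℕ (sym x≡i₁)) (ℕₚ.<-trans i₁<i₂ i₂<x))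
                         | dec-false (x Finₚ.≟ i₂) (λ x≡i₂ → ℕₚ.<-irrefl (cong toℕ (sym x≡i₂)) i₂<x) = refl

  countᵇ-D₂′ : ∀ (r : Fin n → Bool) → countᵇ r D₂′ ℕ.+ indicator (r i₂) ≡ countᵇ r D₂ ℕ.+ indicator (r i₁)
  countᵇ-D₂′ r = begin
    countᵇ r D₂′ ℕ.+ indicator (r i₂)
      ≡⟨ cong₂ ℕ._+_ (countᵇ-filterᵇ in₂′ r (allFin n)) (sym (countᵇ-allFin-≟ i₂ r)) ⟩
    countᵇ (λ x → in₂′ x ∧ r x) (allFin n) ℕ.+ countᵇ (λ x → does (x Finₚ.≟ i₂) ∧ r x) (allFin n)
      ≡⟨ countᵇ-+-cong _ _ _ _ (allFin n) (in₂′-exchange r) ⟩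
    countᵇ (λ x → in₂ x ∧ r x) (allFin n) ℕ.+ countᵇ (λ x → does (x Finₚ.≟ i₁) ∧ r x) (allFin n)
      ≡⟨ cong₂ ℕ._+_ (sym (countᵇ-filterᵇ in₂ r (allFin n))) (countᵇ-allFin-≟ i₁ r) ⟩
    countᵇ r D₂ ℕ.+ indicator (r i₁) ∎
    where open ≡-Reasoning

  length-D₂′ : length D₂′ ≡ length D₂
  length-D₂′ = ℕₚ.+-cancelʳ-≡ 1 _ _ (begin
    length D₂′ ℕ.+ 1               ≡⟨ cong (ℕ._+ 1) (sym (countᵇ-true D₂′)) ⟩
    countᵇ (λ _ → true) D₂′ ℕ.+ 1  ≡⟨ countᵇ-D₂′ (λ _ → true) ⟩
    countᵇ (λ _ → true) D₂ ℕ.+ 1   ≡⟨ cong (ℕ._+ 1) (countᵇ-true D₂) ⟩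
    length D₂ ℕ.+ 1                ∎)
    where open ≡-Reasoning

  D₂′≤D₂ : D₂′ ≤ₛ D₂
  D₂′≤D₂ = ≤ₛ-byCounting D₂′ D₂ (filterᵇ-increasing in₂′) (filterᵇ-increasing in₂) length-D₂′ counts
    where
    i₂≤t⇒i₁≤t : ∀ t → indicator (atMost t i₂) ℕ.≤ indicator (atMost t i₁)
    i₂≤t⇒i₁≤t t with atMost t i₂ in i₂≤t
    ... | false = z≤n
    ... | true rewrite dec-true (i₁ Finₚ.≤? t) (ℕₚ.≤-trans (ℕₚ.<⇒≤ i₁<i₂) (dec-true⁻¹ (i₂ Finₚ.≤? t) i₂≤t)) = ℕₚ.≤-refl
    counts : ∀ t → countᵇ (atMost t) D₂ ℕ.≤ countᵇ (atMost t) D₂′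
    counts t = ℕₚ.+-cancelʳ-≤ (indicator (atMost t i₁)) _ _
      (subst (ℕ._≤ countᵇ (atMost t) D₂′ ℕ.+ indicator (atMost t i₁)) (countᵇ-D₂′ (atMost t))
             (ℕₚ.+-monoʳ-≤ (countᵇ (atMost t) D₂′) (i₂≤t⇒i₁≤t t)))

  countᵇ-bits₀ : countᵇ id bits₀ ≡ length D₁
  countᵇ-bits₀ = trans (sym (proj₁ (length-select entries bits₀ (length-map bit₀ entries))))
                       (trans (sym (length-map label (select true entries bits₀))) (cong length labels₀-left))

  length-entries : length entries ≡ length D₁ ℕ.+ length D₂
  length-entries = begin
    length entries
      ≡⟨ sym (proj₂ (length-select entries bits₀ (length-map bit₀ entries))) ⟩
    length (select false entries bits₀) ℕ.+ countᵇ id bits₀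
      ≡⟨ cong₂ ℕ._+_ (trans (sym (length-map label (select false entries bits₀)))
                            (trans (cong length labels₀-right) length-D₂′))
                     countᵇ-bits₀ ⟩
    length D₂ ℕ.+ length D₁
      ≡⟨ ℕₚ.+-comm (length D₂) (length D₁) ⟩
    length D₁ ℕ.+ length D₂ ∎
    where open ≡-Reasoning

  leftLabels rightLabels : List Bool → List (Fin n)
  leftLabels  bs = labels (select true  entries bs)
  rightLabels bs = labels (select false entries bs)

  diagramOf : List Bool → Diagram n
  diagramOf bs = setColumn (setColumn D j₂ (rightLabels bs)) j₁ (leftLabels bs)

  Admissible : List Bool → Set
  Admissible bs = length bs ≡ length entries × admissible entries bs ≡ true

  module _ {bs : List Bool} (adm : Admissible bs) where

    leftLabels-increasing : AllPairs Fin._<_ (leftLabels bs)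
    leftLabels-increasing = selected-increasing true (allFin n) bs allFin-increasing (proj₁ adm) (proj₂ adm)

    rightLabels-increasing : AllPairs Fin._<_ (rightLabels bs)
    rightLabels-increasing = selected-increasing false (allFin n) bs allFin-increasing (proj₁ adm) (proj₂ adm)

    col-diagramOf-j₁ : col (diagramOf bs) j₁ ≡ leftLabels bs
    col-diagramOf-j₁ = col-setColumn (setColumn D j₂ (rightLabels bs)) j₁ (leftLabels bs) leftLabels-increasing

    col-diagramOf-j₂ : col (diagramOf bs) j₂ ≡ rightLabels bs
    col-diagramOf-j₂ = trans (col-setColumn-≢ (setColumn D j₂ (rightLabels bs)) j₁ (leftLabels bs) j₂ (j₁≢j₂ ∘ sym))
                             (col-setColumn D j₂ (rightLabels bs) rightLabels-increasing)

    diagramOf-≤D : leftLabels bs ≤ₛ D₁ → rightLabels bs ≤ₛ D₂ → diagramOf bs ≤D D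
    diagramOf-≤D left≤ right≤ =
      col-setColumn-≤ₛ (setColumn D j₂ (rightLabels bs)) D j₁ (leftLabels bs) leftLabels-increasing left≤
        (λ j _ → col-setColumn-≤ₛ D D j₂ (rightLabels bs) rightLabels-increasing right≤
                   (λ j′ _ → Pointwiseₚ.refl ℕₚ.≤-refl) j)

  col-diagramOf-other : ∀ bs j → j ≢ j₁ → j ≢ j₂ → col (diagramOf bs) j ≡ col D j
  col-diagramOf-other bs j j≢j₁ j≢j₂ =
    trans (col-setColumn-≢ (setColumn D j₂ (rightLabels bs)) j₁ (leftLabels bs) j j≢j₁)
          (col-setColumn-≢ D j₂ (rightLabels bs) j j≢j₂)

  diagramOf-injective : ∀ {bs cs} → Admissible bs → Admissible cs → diagramOf bs ≐ diagramOf cs → bs ≡ cs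
  diagramOf-injective {bs} {cs} adm-bs@(lb , ab) adm-cs@(lc , ac) same =
    selected-injective (allFin n) bs cs allFin-increasing lb lc ab ac
      (trans (sym (col-diagramOf-j₁ adm-bs)) (trans (filterᵇ-cong (allFin n) (All.tabulate (λ {x} _ → same x j₁)))
                                                    (col-diagramOf-j₁ adm-cs)))

  bits₀-admissible : Admissible bits₀
  bits₀-admissible = length-map bit₀ entries , admissible-map-bit₀ entries

  diagramOf-bits₀-≤D : diagramOf bits₀ ≤D D
  diagramOf-bits₀-≤D = diagramOf-≤D bits₀-admissible (subst (_≤ₛ D₁) (sym labels₀-left) (Pointwiseₚ.refl ℕₚ.≤-refl))
                                                      (subst (_≤ₛ D₂) (sym labels₀-right) D₂′≤D₂)

  lessThan-i₁-ignores-window : ∀ x a → not (inWindow x) ∧ a ∧ lessThan i₁ x ≡ a ∧ lessThan i₁ x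
  lessThan-i₁-ignores-window x a with lessThan i₁ x in x<i₁
  ... | true  rewrite inWindow-below (lessThan⁻¹ x<i₁) = refl
  ... | false rewrite Boolₚ.∧-zeroʳ a = Boolₚ.∧-zeroʳ (not (inWindow x))

  countᵇ-onLeft-entries : countᵇ (onLeft (lessThan i₁)) entries ≡ countᵇ (lessThan i₁) D₁
  countᵇ-onLeft-entries =
    trans (countᵇ-concatMap (onLeft (lessThan i₁)) entriesAt (λ x → in₁ x ∧ lessThan i₁ x) (allFin n)
             (λ x → trans (countᵇ-onLeft-rowEntries (lessThan i₁) x (inWindow x) (in₁ x) (in₂ x))
                          (cong indicator (lessThan-i₁-ignores-window x (in₁ x)))))
          (sym (countᵇ-filterᵇ in₁ (lessThan i₁) (allFin n)))

  countᵇ-onRight-entries : countᵇ (onRight (lessThan i₁)) entries ≡ countᵇ (lessThan i₁) D₂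
  countᵇ-onRight-entries =
    trans (countᵇ-concatMap (onRight (lessThan i₁)) entriesAt (λ x → in₂ x ∧ lessThan i₁ x) (allFin n)
             (λ x → trans (countᵇ-onRight-rowEntries (lessThan i₁) x (inWindow x) (in₁ x) (in₂ x))
                          (cong indicator (lessThan-i₁-ignores-window x (in₂ x)))))
          (sym (countᵇ-filterᵇ in₂ (lessThan i₁) (allFin n)))

  module _ {bs : List Bool} (len : length bs ≡ length entries) (#left : countᵇ id bs ≡ length D₁) where

    length-leftRows : length (select true entries bs) ≡ length D₁
    length-leftRows = trans (proj₁ (length-select entries bs len)) #left

    length-rightRows : length (select false entries bs) ≡ length D₂
    length-rightRows = ℕₚ.+-cancelʳ-≡ (length D₁) _ _
      (trans (cong (length (select false entries bs) ℕ.+_) (sym #left))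
             (trans (proj₂ (length-select entries bs len)) (trans length-entries (ℕₚ.+-comm (length D₁) (length D₂)))))

  allSplits : List (List Bool × ℚ)
  allSplits = splits entries (length D₁)

  allSplits-isSplit : All (IsSplit entries (length D₁)) allSplits
  allSplits-isSplit = splits-isSplit entries (length D₁)

  Keep : List Bool × ℚ → Set
  Keep (bs , σ) = admissible entries bs ≡ true × diagramOf bs ≤D D

  keep? : Decidable Keep
  keep? (bs , σ) = (admissible entries bs Boolₚ.≟ true)
                   ×-dec Finₚ.all? (λ j → Pointwiseₚ.decidable Finₚ._≤?_ (col (diagramOf bs) j) (col D j))

  kept : List (List Bool × ℚ)
  kept = filter keep? allSplits

  kept-valid : All (λ s → IsSplit entries (length D₁) s × Keep s) kept
  kept-valid = All.zip (Allₚ.filter⁺ keep? allSplits-isSplit , Allₚ.all-filter keep? allSplits)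

  module AtPoint (y : Fin n → Fin n → ℚ) where

    Y : Fin n → Fin n → ℚ
    Y = Yentry y

    onlyAtI₂ : Fin n → Fin n → ℚ
    onlyAtI₂ x c = if does (c Finₚ.≟ i₂) then Y x i₂ else 0ℚ

    leftRow rightRow : Entry n → Fin n → ℚ
    leftRow (x , left)   = Y x
    leftRow (x , right)  = onlyAtI₂ x
    leftRow (x , shared) = Y x
    rightRow (x , left)   = onlyAtI₂ x
    rightRow (x , right)  = Y x
    rightRow (x , shared) = Y x

    open Laplace leftRow rightRow public

    onlyAtI₂-at-i₂ : ∀ x → onlyAtI₂ x i₂ ≡ Y x i₂
    onlyAtI₂-at-i₂ x = cong (λ b → if b then Y x i₂ else 0ℚ) (dec-true (i₂ Finₚ.≟ i₂) refl)

    onlyAtI₂-off : ∀ x c → c Fin.< i₂ → onlyAtI₂ x c ≡ 0ℚ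
    onlyAtI₂-off x c c<i₂ =
      cong (λ b → if b then Y x i₂ else 0ℚ) (dec-false (c Finₚ.≟ i₂) (λ c≡i₂ → ℕₚ.<-irrefl (cong toℕ c≡i₂) c<i₂))

    onlyAtI₂-above : ∀ x → i₂ Fin.< x → ∀ c → onlyAtI₂ x c ≡ 0ℚ
    onlyAtI₂-above x i₂<x c with does (c Finₚ.≟ i₂)
    ... | true  = Yentry-below y x i₂ i₂<x
    ... | false = refl

    rows-agree-at-i₂ : ∀ e → leftRow e i₂ ≡ rightRow e i₂
    rows-agree-at-i₂ (x , left)   = sym (onlyAtI₂-at-i₂ x)
    rows-agree-at-i₂ (x , right)  = onlyAtI₂-at-i₂ x
    rows-agree-at-i₂ (x , shared) = refl

    auxiliary-det≡0 : detRows (map joinRow entries) (map inj₁ D₁ ++ map inj₂ D₂) ≡ 0ℚ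
    auxiliary-det≡0 with Memₚ.∈-∃++ (∈-filterᵇ-allFin in₁ i₂∈D₁) | Memₚ.∈-∃++ (∈-filterᵇ-allFin in₂ i₂∈D₂)
    ... | P , Q , D₁≡ | R , S , D₂≡ =
      subst₂ (λ L₁ L₂ → detRows (map joinRow entries) (map inj₁ L₁ ++ map inj₂ L₂) ≡ 0ℚ) (sym D₁≡) (sym D₂≡)
        (detRows-commonColumn entries i₂ P Q R S
                              (subst₂ (λ L₁ L₂ → length entries ≡ length L₁ ℕ.+ length L₂) D₁≡ D₂≡ length-entries)
                              (All.tabulate (λ {e} _ → rows-agree-at-i₂ e)))

    leftRow-below-i₁ : ∀ {e} → Placed e → onLeft (lessThan i₁) e ≡ false →
      ∀ c → lessThan i₁ c ≡ true → leftRow e c ≡ 0ℚ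
    leftRow-below-i₁ {x , left}   _          x≮i₁ c c<i₁ =
      Yentry-below y x c (ℕₚ.<-≤-trans (lessThan⁻¹ c<i₁) (ℕₚ.≮⇒≥ (dec-false⁻¹ (x Finₚ.<? i₁) x≮i₁)))
    leftRow-below-i₁ {x , shared} (i₁≤x , _) _    c c<i₁ = Yentry-below y x c (ℕₚ.<-≤-trans (lessThan⁻¹ c<i₁) i₁≤x)
    leftRow-below-i₁ {x , right}  _          _    c c<i₁ = onlyAtI₂-off x c (ℕₚ.<-trans (lessThan⁻¹ c<i₁) i₁<i₂)

    rightRow-below-i₁ : ∀ {e} → Placed e → onRight (lessThan i₁) e ≡ false →
      ∀ c → lessThan i₁ c ≡ true → rightRow e c ≡ 0ℚ
    rightRow-below-i₁ {x , right}  _          x≮i₁ c c<i₁ =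
      Yentry-below y x c (ℕₚ.<-≤-trans (lessThan⁻¹ c<i₁) (ℕₚ.≮⇒≥ (dec-false⁻¹ (x Finₚ.<? i₁) x≮i₁)))
    rightRow-below-i₁ {x , shared} (i₁≤x , _) _    c c<i₁ = Yentry-below y x c (ℕₚ.<-≤-trans (lessThan⁻¹ c<i₁) i₁≤x)
    rightRow-below-i₁ {x , left}   _          _    c c<i₁ = onlyAtI₂-off x c (ℕₚ.<-trans (lessThan⁻¹ c<i₁) i₁<i₂)

    -- A misplaced entry x > i₂ is a zero row; one with x < i₁ leaves its own block too few rows
    -- for the columns c < i₁.
    laplaceTerm-misplaced : ∀ {bs} σ → length bs ≡ length entries → countᵇ id bs ≡ length D₁ →
      admissible entries bs ≡ false → laplaceTerm entries D₁ D₂ (bs , σ) ≡ 0ℚ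
    laplaceTerm-misplaced {bs} σ len #left adm = σ*[a*b]≡0 σ (vanishing-block (misplaced entries bs len adm))
      where
      Rs Ss : List (Entry n)
      Rs = select true entries bs
      Ss = select false entries bs
      placed : ∀ v → All Placed (select v entries bs)
      placed v = select-All v entries bs (entriesFrom-placed (allFin n))
      fewer-left : ∀ {x} → (x , left) ∈ Ss → x Fin.< i₁ → countᵇ (onLeft (lessThan i₁)) Rs ℕ.< countᵇ (lessThan i₁) D₁
      fewer-left {x} x∈S x<i₁ =
        subst (countᵇ (onLeft (lessThan i₁)) Rs ℕ.<_) countᵇ-onLeft-entries
              (countᵇ-select-< (onLeft (lessThan i₁)) true entries bs len x∈S (dec-true (x Finₚ.<? i₁) x<i₁))
      fewer-right : ∀ {x} → (x , right) ∈ Rs → x Fin.< i₁ → countᵇ (onRight (lessThan i₁)) Ss ℕ.< countᵇ (lessThan i₁) D₂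
      fewer-right {x} x∈R x<i₁ =
        subst (countᵇ (onRight (lessThan i₁)) Ss ℕ.<_) countᵇ-onRight-entries
              (countᵇ-select-< (onRight (lessThan i₁)) false entries bs len x∈R (dec-true (x Finₚ.<? i₁) x<i₁))
      vanishing-block : Misplaced entries bs → detRows (map leftRow Rs) D₁ ≡ 0ℚ ⊎ detRows (map rightRow Ss) D₂ ≡ 0ℚ
      vanishing-block (x , inj₁ x∈S) with proj₁ (All.lookup (placed false) x∈S)
      ... | inj₁ x<i₁ = inj₁ (detRows-fewSupportingRows leftRow (onLeft (lessThan i₁)) (lessThan i₁) Rs D₁
                               (length-leftRows len #left) (fewer-left x∈S x<i₁) (All.map leftRow-below-i₁ (placed true)))
      ... | inj₂ i₂<x = inj₂ (detRows-zeroRow (map rightRow Ss) D₂ (Memₚ.∈-map⁺ rightRow x∈S) (onlyAtI₂-above x i₂<x)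
                                              (trans (length-map rightRow Ss) (length-rightRows len #left)))
      vanishing-block (x , inj₂ x∈R) with proj₁ (All.lookup (placed true) x∈R)
      ... | inj₁ x<i₁ = inj₂ (detRows-fewSupportingRows rightRow (onRight (lessThan i₁)) (lessThan i₁) Ss D₂
                               (length-rightRows len #left) (fewer-right x∈R x<i₁) (All.map rightRow-below-i₁ (placed false)))
      ... | inj₂ i₂<x = inj₁ (detRows-zeroRow (map leftRow Rs) D₁ (Memₚ.∈-map⁺ leftRow x∈R) (onlyAtI₂-above x i₂<x)
                                              (trans (length-map leftRow Rs) (length-leftRows len #left)))

    leftRow-admissible : ∀ T bs → admissible T bs ≡ true →
      map leftRow (select true T bs) ≡ map Y (labels (select true T bs))
    leftRow-admissible []                 bs           adm = refl
    leftRow-admissible (e ∷ T)            []           adm = refl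
    leftRow-admissible ((x , left)   ∷ T) (true  ∷ bs) adm = cong (Y x ∷_) (leftRow-admissible T bs adm)
    leftRow-admissible ((x , left)   ∷ T) (false ∷ bs) ()
    leftRow-admissible ((x , right)  ∷ T) (true  ∷ bs) ()
    leftRow-admissible ((x , right)  ∷ T) (false ∷ bs) adm = leftRow-admissible T bs adm
    leftRow-admissible ((x , shared) ∷ T) (true  ∷ bs) adm = cong (Y x ∷_) (leftRow-admissible T bs adm)
    leftRow-admissible ((x , shared) ∷ T) (false ∷ bs) adm = leftRow-admissible T bs adm

    rightRow-admissible : ∀ T bs → admissible T bs ≡ true →
      map rightRow (select false T bs) ≡ map Y (labels (select false T bs))
    rightRow-admissible []                 bs           adm = refl
    rightRow-admissible (e ∷ T)            []           adm = refl
    rightRow-admissible ((x , left)   ∷ T) (true  ∷ bs) adm = rightRow-admissible T bs adm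
    rightRow-admissible ((x , left)   ∷ T) (false ∷ bs) ()
    rightRow-admissible ((x , right)  ∷ T) (true  ∷ bs) ()
    rightRow-admissible ((x , right)  ∷ T) (false ∷ bs) adm = cong (Y x ∷_) (rightRow-admissible T bs adm)
    rightRow-admissible ((x , shared) ∷ T) (true  ∷ bs) adm = rightRow-admissible T bs adm
    rightRow-admissible ((x , shared) ∷ T) (false ∷ bs) adm = cong (Y x ∷_) (rightRow-admissible T bs adm)

    laplaceTerm-admissible : ∀ {bs} σ → admissible entries bs ≡ true →
      laplaceTerm entries D₁ D₂ (bs , σ) ≡ σ * (det (subY y (leftLabels bs) D₁) * det (subY y (rightLabels bs) D₂))
    laplaceTerm-admissible {bs} σ adm =
      cong₂ (λ a b → σ * (a * b))
            (trans (cong (λ G → detRows G D₁) (leftRow-admissible entries bs adm)) (sym (det-subY y (leftLabels bs) D₁)))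
            (trans (cong (λ G → detRows G D₂) (rightRow-admissible entries bs adm)) (sym (det-subY y (rightLabels bs) D₂)))

    laplaceTerm-not-≤D : ∀ {bs} σ → (adm : Admissible bs) → countᵇ id bs ≡ length D₁ → ¬ diagramOf bs ≤D D →
      laplaceTerm entries D₁ D₂ (bs , σ) ≡ 0ℚ
    laplaceTerm-not-≤D {bs} σ adm@(len , adm′) #left C≰D =
      trans (laplaceTerm-admissible σ adm′)
            (σ*[a*b]≡0 σ (by-cases (Pointwiseₚ.decidable Finₚ._≤?_ (leftLabels bs) D₁)
                                   (Pointwiseₚ.decidable Finₚ._≤?_ (rightLabels bs) D₂)))
      where
      by-cases : Dec (leftLabels bs ≤ₛ D₁) → Dec (rightLabels bs ≤ₛ D₂) →
        det (subY y (leftLabels bs) D₁) ≡ 0ℚ ⊎ det (subY y (rightLabels bs) D₂) ≡ 0ℚ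
      by-cases (yes left≤) (yes right≤) = ⊥-elim (C≰D (diagramOf-≤D adm left≤ right≤))
      by-cases (no left≰)  _            =
        inj₁ (det-subY-unless-≤ₛ y _ D₁ (leftLabels-increasing adm) (filterᵇ-increasing in₁)
                                 (trans (length-map label (select true entries bs)) (length-leftRows len #left)) left≰)
      by-cases (yes _)     (no right≰)  =
        inj₂ (det-subY-unless-≤ₛ y _ D₂ (rightLabels-increasing adm) (filterᵇ-increasing in₂)
                                 (trans (length-map label (select false entries bs)) (length-rightRows len #left)) right≰)

    minor : Diagram n → Fin n → ℚ
    minor C j = det (subY y (col C j) (col D j))

    commonFactor : ℚ
    commonFactor = prodℚ (map (except j₂ (except j₁ (minor D))) (allFin n))

    detYD-diagramOf : ∀ {bs} → Admissible bs →
      detYD y (diagramOf bs) D ≡ det (subY y (leftLabels bs) D₁) * (det (subY y (rightLabels bs) D₂) * commonFactor)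
    detYD-diagramOf {bs} adm = begin
      prodℚ (map f (allFin n))
        ≡⟨ prodℚ-allFin-except f j₁ ⟩
      f j₁ * prodℚ (map (except j₁ f) (allFin n))
        ≡⟨ cong (f j₁ *_) (prodℚ-allFin-except (except j₁ f) j₂) ⟩
      f j₁ * (except j₁ f j₂ * prodℚ (map (except j₂ (except j₁ f)) (allFin n)))
        ≡⟨ cong₂ (λ a b → f j₁ * (a * b))
                 (cong (λ b → if b then 1ℚ else f j₂) (dec-false (j₂ Finₚ.≟ j₁) (j₁≢j₂ ∘ sym)))
                 (cong prodℚ (map-cong (except-cong f (minor D) j₁ j₂ other-columns) (allFin n))) ⟩
      f j₁ * (f j₂ * commonFactor)
        ≡⟨ cong₂ (λ a b → a * (b * commonFactor)) (cong (λ L → det (subY y L D₁)) (col-diagramOf-j₁ adm))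
                                       (cong (λ L → det (subY y L D₂)) (col-diagramOf-j₂ adm)) ⟩
      det (subY y (leftLabels bs) D₁) * (det (subY y (rightLabels bs) D₂) * commonFactor) ∎
      where
      open ≡-Reasoning
      f : Fin n → ℚ
      f = minor (diagramOf bs)
      other-columns : ∀ j → j ≢ j₁ → j ≢ j₂ → f j ≡ minor D j
      other-columns j j≢j₁ j≢j₂ = cong (λ L → det (subY y L (col D j))) (col-diagramOf-other bs j j≢j₁ j≢j₂)

    laplaceTerm-kept : ∀ {s} → IsSplit entries (length D₁) s × Keep s →
      proj₂ s * detYD y (diagramOf (proj₁ s)) D ≡ commonFactor * laplaceTerm entries D₁ D₂ s
    laplaceTerm-kept {bs , σ} ((len , _ , _) , adm , _) =
      trans (cong (σ *_) (detYD-diagramOf (len , adm)))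
            (trans (solve 4 (λ s a b k → s :* (a :* (b :* k)) := k :* (s :* (a :* b))) refl σ
                           (det (subY y (leftLabels bs) D₁)) (det (subY y (rightLabels bs) D₂)) commonFactor)
                   (cong (commonFactor *_) (sym (laplaceTerm-admissible σ adm))))

    laplaceTerm-discarded : ∀ {s} → IsSplit entries (length D₁) s → ¬ Keep s → laplaceTerm entries D₁ D₂ s ≡ 0ℚ
    laplaceTerm-discarded {bs , σ} (len , #left , _) ¬keep with admissible entries bs in adm
    ... | false = laplaceTerm-misplaced σ len #left adm
    ... | true  = laplaceTerm-not-≤D σ (len , adm) #left (λ C≤D → ¬keep (refl , C≤D))


  terms : List (Diagram n × ℚ)
  terms = map (λ (bs , σ) → diagramOf bs , σ) kept

  terms-≤D : All (λ t → proj₁ t ≤D D) terms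
  terms-≤D = Allₚ.map⁺ (All.map (λ (_ , _ , C≤D) → C≤D) kept-valid)

  terms-distinct : AllPairs (λ s t → ¬ (proj₁ s ≐ proj₁ t)) terms
  terms-distinct = AllPairsₚ.map⁺ (AllPairs-restrict kept-valid (AllPairsₚ.filter⁺ keep? (splits-distinct entries (length D₁)))
    (λ ((len , _) , adm , _) ((len′ , _) , adm′ , _) bs≢cs same →
       bs≢cs (diagramOf-injective (len , adm) (len′ , adm′) same)))

  terms-nonzero : Any (λ t → ¬ (proj₂ t ≡ 0ℚ)) terms
  terms-nonzero with splits-complete entries (length D₁) bits₀ (length-map bit₀ entries) countᵇ-bits₀
  ... | σ₀ , ∈splits =
    Anyₚ.map⁺ (Any.map (λ { refl → isSign⇒≢0 (proj₂ (proj₂ (All.lookup allSplits-isSplit ∈splits))) })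
                       (Memₚ.∈-filter⁺ keep? ∈splits (admissible-map-bit₀ entries , diagramOf-bits₀-≤D)))

  relation : ∀ y → sumℚ (map (λ t → proj₂ t * detYD y (proj₁ t) D) terms) ≡ 0ℚ
  relation y = begin
    sumℚ (map (λ t → proj₂ t * detYD y (proj₁ t) D) terms)
      ≡⟨ cong sumℚ (sym (map-∘ kept)) ⟩
    sumℚ (map (λ s → proj₂ s * detYD y (diagramOf (proj₁ s)) D) kept)
      ≡⟨ cong sumℚ (map-cong-local (All.map laplaceTerm-kept kept-valid)) ⟩
    sumℚ (map (λ s → commonFactor * laplaceTerm entries D₁ D₂ s) kept)
      ≡⟨ sumℚ-*ˡ commonFactor (laplaceTerm entries D₁ D₂) kept ⟩
    commonFactor * sumℚ (map (laplaceTerm entries D₁ D₂) kept)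
      ≡⟨ cong (commonFactor *_) (sumℚ-filter keep? _ _ (All.map laplaceTerm-discarded allSplits-isSplit)) ⟩
    commonFactor * sumℚ (map (laplaceTerm entries D₁ D₂) allSplits)
      ≡⟨ cong (commonFactor *_) (sym (detRows-laplace entries D₁ D₂ length-entries)) ⟩
    commonFactor * detRows (map joinRow entries) (map inj₁ D₁ ++ map inj₂ D₂)
      ≡⟨ cong (commonFactor *_) auxiliary-det≡0 ⟩
    commonFactor * 0ℚ
      ≡⟨ ℚₚ.*-zeroʳ commonFactor ⟩
    0ℚ ∎
    where
    open ≡-Reasoning
    open AtPoint y

  linearlyDependent : LinDepFamily D
  linearlyDependent = terms , terms-≤D , terms-distinct , terms-nonzero , relation

theorem3p1 : (n : ℕ) (D : Diagram n) → HasPattern D → LinDepFamily D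
theorem3p1 n D occurrence = Pattern.linearlyDependent D (normalise D occurrence)
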